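{- For every $n\geq 7$ there is a totally chiral hypermap whose monodromy group is isomorphic to the alternating group $A_n$.
   Context: Let $\Delta=\langle r_0,r_1,r_2\mid r_0^2=r_1^2=r_2^2=1\rangle$ and let $\Delta^+$ be its index-$2$ subgroup of even-length words, generated by $\rho=r_1r_2$ and $\lambda=r_2r_0$. An (oriented) hypermap is a triple $\mathcal H=(D,R,L)$ with $D$ a finite set and $R,L$ permutations of $D$ such that the monodromy group $\mathrm{Mon}(\mathcal H)=\langle R,L\rangle$ is transitive on $D$. It is orientably regular if its automorphism group (permutations of $D$ commuting with $R$ and $L$) acts regularly on $D$; then $\mathcal H\cong(\Delta^+/H,\rho,\lambda)$ (left multiplication on cosets) for a unique normal subgroup $H$ of finite index in $\Delta^+$ (the hypermap subgroup), and $\mathrm{Mon}(\mathcal H)\cong\Delta^+/H$. For $H\trianglelefteq\Delta^+$ put $H^r=r_2Hr_2$. An orientably regular hypermap is totally chiral if $HH^r=\Delta^+$, i.e. its chirality group $HH^r/H$ equals its whole monodromy group $\Delta^+/H$. -}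

module Defs where

open import Data.Nat using (ℕ; _<_; _%_)
open import Data.Fin using (Fin; toℕ)
open import Data.Fin.Permutation using (Permutation′; _⟨$⟩ʳ_; _⟨$⟩ˡ_)
open import Data.List using (List; []; _∷_; _++_; map; foldr; sum; length; filter)
open import Data.List using (allFin; cartesianProduct)
open import Relation.Nullary.Decidable using (_×-dec_)
open import Data.Product using (Σ; ∃; _×_; _,_; proj₁; proj₂)
open import Relation.Binary.PropositionalEquality using (_≡_)
open import Relation.Nullary using (¬_)
open import Data.Nat.Properties using (_<?_)

-- The group Δ⁺ = ⟨ρ, λ⟩ (free of rank 2, ρ = r₁r₂, λ = r₂r₀).
-- Elements are represented by words in ρ, ρ⁻¹, λ, λ⁻¹ modulo free
-- cancellation (the relation _∼_ below).

data Letter : Set where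
  ρ  : Letter
  ρ⁻ : Letter
  ℓ  : Letter
  ℓ⁻ : Letter

invL : Letter → Letter
invL ρ  = ρ⁻
invL ρ⁻ = ρ
invL ℓ  = ℓ⁻
invL ℓ⁻ = ℓ

Word : Set
Word = List Letter

data _∼_ : Word → Word → Set where
  ∼-refl   : ∀ {u} → u ∼ u
  ∼-sym    : ∀ {u v} → u ∼ v → v ∼ u
  ∼-trans  : ∀ {u v w} → u ∼ v → v ∼ w → u ∼ w
  ∼-cancel : ∀ u x v → (u ++ (x ∷ invL x ∷ v)) ∼ (u ++ v)

-- conjugation by r₂ : w ↦ r₂ w r₂.  Since r₂ρr₂ = r₂r₁ = ρ⁻¹ and
-- r₂λr₂ = r₀r₂ = λ⁻¹, it inverts each generator letterwise.
conjR₂ : Word → Word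
conjR₂ = map invL

-- Hypermaps with dart set Fin m (any finite set up to bijection).

record Hypermap : Set where
  field
    m : ℕ
    R : Permutation′ m
    L : Permutation′ m

module _ (H : Hypermap) where
  open Hypermap H

  actL : Letter → Fin m → Fin m
  actL ρ  = R ⟨$⟩ʳ_
  actL ρ⁻ = R ⟨$⟩ˡ_
  actL ℓ  = L ⟨$⟩ʳ_
  actL ℓ⁻ = L ⟨$⟩ˡ_

  act : Word → Fin m → Fin m
  act [] d      = d
  act (x ∷ w) d = actL x (act w d)

  Transitive : Set
  Transitive = ∀ (d e : Fin m) → ∃ λ (w : Word) → act w d ≡ e

  IsAut : Permutation′ m → Set
  IsAut a = ∀ (d : Fin m) →
              (a ⟨$⟩ʳ (R ⟨$⟩ʳ d) ≡ R ⟨$⟩ʳ (a ⟨$⟩ʳ d))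
            × (a ⟨$⟩ʳ (L ⟨$⟩ʳ d) ≡ L ⟨$⟩ʳ (a ⟨$⟩ʳ d))

  OrientablyRegular : Set
  OrientablyRegular =
      (∀ (d e : Fin m) → ∃ λ (a : Permutation′ m) → IsAut a × (a ⟨$⟩ʳ d ≡ e))
    × (∀ (a : Permutation′ m) → IsAut a → ∀ (d : Fin m) → a ⟨$⟩ʳ d ≡ d →
         ∀ (e : Fin m) → a ⟨$⟩ʳ e ≡ e)

  -- hypermap subgroup H (for a regular hypermap: the kernel of the
  -- monodromy action Δ⁺ → Mon(𝓗)), and H^r = r₂ H r₂
  InH : Word → Set
  InH w = ∀ (d : Fin m) → act w d ≡ d

  InHr : Word → Set
  InHr w = InH (conjR₂ w)

  TotallyChiral : Set
  TotallyChiral = ∀ (w : Word) → ∃ λ (h : Word) → ∃ λ (h′ : Word) →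
                    InH h × InHr h′ × (w ∼ (h ++ h′))

inversions : ∀ {n} → Permutation′ n → ℕ
inversions {n} π =
  length (filter (λ p → (toℕ (proj₁ p) <? toℕ (proj₂ p))
                        ×-dec (toℕ (π ⟨$⟩ʳ proj₂ p) <? toℕ (π ⟨$⟩ʳ proj₁ p)))
                 (cartesianProduct (allFin n) (allFin n)))

IsEven : ∀ {n} → Permutation′ n → Set
IsEven π = inversions π % 2 ≡ 0

-- Mon(𝓗) ≅ A_n.  Elements of Mon(𝓗) are represented by words of Δ⁺
-- (two words representing the same element iff they act identically);
-- φ is an isomorphism Mon(𝓗) → A_n.
MonIsoAlt : Hypermap → ℕ → Set
MonIsoAlt H n =
  let open Hypermap H in
  ∃ λ (φ : Word → Permutation′ n) →
      (∀ (u v : Word) → (∀ d → act H u d ≡ act H v d) →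
          ∀ i → φ u ⟨$⟩ʳ i ≡ φ v ⟨$⟩ʳ i)
    × (∀ (u v : Word) → (∀ i → φ u ⟨$⟩ʳ i ≡ φ v ⟨$⟩ʳ i) →
          ∀ d → act H u d ≡ act H v d)
    × (∀ (u v : Word) → ∀ i → φ (u ++ v) ⟨$⟩ʳ i ≡ φ u ⟨$⟩ʳ (φ v ⟨$⟩ʳ i))
    × (∀ (u : Word) → IsEven (φ u))
    × (∀ (π : Permutation′ n) → IsEven π →
          ∃ λ (u : Word) → ∀ i → φ u ⟨$⟩ʳ i ≡ π ⟨$⟩ʳ i)

-- Let a be the 5-cycle (0 1 2 4 3) and b the translation x ↦ x + 2 of ℤ/n; both are even (a is
-- the square of a³, b the square of x ↦ x + 1).  The darts are the elements of A_n, with R and L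
-- acting by left multiplication by a and b, so right multiplications are automorphisms: the
-- hypermap is orientably regular with Mon ≅ A_n as soon as a and b generate A_n.  Conjugation by
-- r₂ inverts ρ and λ, so a word lies in H^r iff its letterwise inverse acts trivially; the image
-- of H^r in A_n (the chirality group) is therefore a subgroup, normalised by b, and total
-- chirality means that it is all of A_n.  Since b τⱼ b⁻¹ = τⱼ₊₂ for the adjacent transpositions
-- τⱼ = (j j+1), the chirality group contains every 3-cycle τᵢτᵢ₊₁ once it contains those for
-- i = 0 and 1, and these 3-cycles generate A_n.  The two base cases are explicit words, checked by
-- evaluation for n = 7, 8; for n ≥ 9 they are products of conjugates of a^{±1} supported on a
-- fixed window of nine points, where the computation no longer depends on n.
-- Evenness is the parity of the number of inversions: composing with an adjacent transposition
-- changes that number by one, and every permutation is a product of adjacent transpositions.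

module Submission where

open import Defs
open import Data.Nat as ℕ using (ℕ; zero; suc; _+_; _<_; _≤_; z≤n; s≤s; _%_; parity)
open import Data.Nat.Properties as ℕ using (n<1+n; <-irrefl; <-asym; <-cmp; ≤-antisym; ≮⇒≥; <-≤-trans; ≤-<-trans; +-identityʳ)
open import Data.Nat.Induction using (<-wellFounded)
open import Data.Parity as ℙ using (Parity; 0ℙ; _⁻¹)
open import Data.Parity.Properties as ℙ using (⁻¹-involutive; suc-homo-⁻¹; +-homo-+; p+p≡0ℙ)
open import Data.Fin as Fin using (Fin; zero; suc; toℕ; inject₁; _↑ˡ_; _↑ʳ_)
open import Data.Fin.Patterns
open import Data.Fin.Properties using (↑ˡ-injective; toℕ-injective; toℕ<n; toℕ-inject₁; toℕ-fromℕ<; any?; all?; _≟_)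
open import Data.Fin.Permutation using (Permutation′; _⟨$⟩ʳ_; _⟨$⟩ˡ_; permutation; inverseˡ; inverseʳ; _≈_; id; flip; _∘ₚ_; lift₀)
open import Data.List using (List; []; _∷_; _++_; [_]; length; map; filter; allFin; cartesianProduct; cartesianProductWith; lookup)
open import Data.List.Properties using (filter-≐; filter-none; map-++; ++-assoc; ++-identityʳ)
open import Data.List.Relation.Unary.All as All using (All; []; _∷_)
open import Data.List.Relation.Unary.Any as Any using (here; there)
open import Data.List.Relation.Unary.Any.Properties using (lookup-index)
open import Data.List.Relation.Unary.AllPairs using ([]; _∷_)
open import Data.List.Relation.Unary.Unique.Propositional using (Unique)
open import Data.List.Relation.Unary.Unique.Propositional.Properties using (cartesianProduct⁺; cartesianProductWith⁺; allFin⁺; filter⁺)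
open import Data.List.Membership.Propositional using (_∈_)
open import Data.List.Membership.Propositional.Properties using (∈-allFin; ∈-cartesianProduct⁺; ∈-cartesianProductWith⁺; ∈-filter⁺; ∈-filter⁻; ∈-lookup)
open import Data.Vec as Vec using (Vec; []; _∷_; tabulate)
open import Data.Vec.Properties using (lookup∘tabulate; tabulate∘lookup; tabulate-cong; ∷-injective)
open import Data.Product using (Σ; ∃; ∃₂; _×_; _,_; proj₁; proj₂)
open import Data.Sum using (inj₁; inj₂)
open import Data.Empty using (⊥-elim)
open import Function using (_⇔_; mk⇔; Equivalence)
open import Induction.WellFounded using (Acc; acc)
open import Relation.Nullary using (¬_; Dec; yes; no)
open import Relation.Nullary.Decidable using (_×-dec_; _→-dec_; recompute; True; toWitness)
open import Relation.Unary using (Decidable)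
open import Relation.Binary using (tri<; tri≈; tri>)
open import Relation.Binary.PropositionalEquality using (_≡_; _≢_; refl; sym; trans; cong; cong₂; subst; subst₂; _≗_; module ≡-Reasoning)

variable
  n p q : ℕ

module _ {A : Set} {P Q : A → Set} (P? : Decidable P) (Q? : Decidable Q) where

  length-filter-cong : ∀ xs → (∀ {x} → x ∈ xs → P x ⇔ Q x) →
                       length (filter P? xs) ≡ length (filter Q? xs)
  length-filter-cong []       P⇔Q = refl
  length-filter-cong (x ∷ xs) P⇔Q with P? x | Q? x
  ... | yes _  | yes _  = cong suc (length-filter-cong xs (λ m → P⇔Q (there m)))
  ... | yes p  | no ¬q  = ⊥-elim (¬q (Equivalence.to (P⇔Q (here refl)) p))
  ... | no ¬p  | yes q  = ⊥-elim (¬p (Equivalence.from (P⇔Q (here refl)) q))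
  ... | no _   | no _   = length-filter-cong xs (λ m → P⇔Q (there m))

  length-filter-except : ∀ xs → Unique xs → ∀ {x₀} → x₀ ∈ xs → P x₀ → ¬ Q x₀ →
                         (∀ {x} → x ≢ x₀ → P x ⇔ Q x) →
                         length (filter P? xs) ≡ suc (length (filter Q? xs))
  length-filter-except (x ∷ xs) (x∉xs ∷ _) (here refl) p ¬q P⇔Q with P? x | Q? x
  ... | no ¬p | _     = ⊥-elim (¬p p)
  ... | yes _ | yes q = ⊥-elim (¬q q)
  ... | yes _ | no _  =
    cong suc (length-filter-cong xs (λ m → P⇔Q (λ eq → All.lookup x∉xs m (sym eq))))
  length-filter-except (x ∷ xs) (x∉xs ∷ u) (there m₀) p ¬q P⇔Q with P? x | Q? x
  ... | yes _  | yes _  = cong suc (length-filter-except xs u m₀ p ¬q P⇔Q)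
  ... | yes p′ | no ¬q′ = ⊥-elim (¬q′ (Equivalence.to (P⇔Q (All.lookup x∉xs m₀)) p′))
  ... | no ¬p′ | yes q′ = ⊥-elim (¬p′ (Equivalence.from (P⇔Q (All.lookup x∉xs m₀)) q′))
  ... | no _   | no _   = length-filter-except xs u m₀ p ¬q P⇔Q

Unique⇒lookup-injective : ∀ {A : Set} {xs : List A} → Unique xs → ∀ {i j} → lookup xs i ≡ lookup xs j → i ≡ j
Unique⇒lookup-injective {xs = x ∷ xs} _           {zero}  {zero}  _  = refl
Unique⇒lookup-injective {xs = x ∷ xs} (x∉xs ∷ _)  {zero}  {suc j} eq = ⊥-elim (All.lookup x∉xs (∈-lookup j) eq)
Unique⇒lookup-injective {xs = x ∷ xs} (x∉xs ∷ _)  {suc i} {zero}  eq = ⊥-elim (All.lookup x∉xs (∈-lookup i) (sym eq))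
Unique⇒lookup-injective {xs = x ∷ xs} (_ ∷ uniq) {suc i} {suc j} eq = cong suc (Unique⇒lookup-injective uniq eq)

-- swap k exchanges k and k + 1, and is the identity when k + 1 is out of range.
swap : ℕ → Fin n → Fin n
swap zero    (zero {suc _}) = 1F
swap zero    (zero {zero})  = 0F
swap zero    (suc zero)     = 0F
swap zero    (suc (suc x))  = suc (suc x)
swap (suc k) zero           = zero
swap (suc k) (suc x)        = suc (swap k x)

swap-involutive : ∀ k (x : Fin n) → swap k (swap k x) ≡ x
swap-involutive zero    (zero {suc _}) = refl
swap-involutive zero    (zero {zero})  = refl
swap-involutive zero    (suc zero)     = refl
swap-involutive zero    (suc (suc x))  = refl
swap-involutive (suc k) zero           = refl
swap-involutive (suc k) (suc x)        = cong suc (swap-involutive k x)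

τ : ℕ → Permutation′ n
τ k = permutation (swap k) (swap k) (swap-involutive k) (swap-involutive k)

swapℕ : ℕ → ℕ → ℕ
swapℕ zero    zero          = 1
swapℕ zero    (suc zero)    = 0
swapℕ zero    (suc (suc v)) = suc (suc v)
swapℕ (suc k) zero          = zero
swapℕ (suc k) (suc v)       = suc (swapℕ k v)

toℕ-swap : ∀ k (x : Fin n) → suc k < n → toℕ (swap k x) ≡ swapℕ k (toℕ x)
toℕ-swap zero    (zero {suc _}) _         = refl
toℕ-swap zero    (zero {zero})  (s≤s ())
toℕ-swap zero    (suc zero)     _         = refl
toℕ-swap zero    (suc (suc x))  _         = refl
toℕ-swap (suc k) zero           _         = refl
toℕ-swap (suc k) (suc x)        (s≤s k<n) = cong suc (toℕ-swap k x k<n)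

swapℕ-involutive : ∀ k v → swapℕ k (swapℕ k v) ≡ v
swapℕ-involutive zero    zero          = refl
swapℕ-involutive zero    (suc zero)    = refl
swapℕ-involutive zero    (suc (suc v)) = refl
swapℕ-involutive (suc k) zero          = refl
swapℕ-involutive (suc k) (suc v)       = cong suc (swapℕ-involutive k v)

swapℕ-self : ∀ k → swapℕ k k ≡ suc k
swapℕ-self zero    = refl
swapℕ-self (suc k) = cong suc (swapℕ-self k)

swapℕ-cancel : ∀ k {u v} → swapℕ k v ≡ u → v ≡ swapℕ k u
swapℕ-cancel k {v = v} eq = trans (sym (swapℕ-involutive k v)) (cong (swapℕ k) eq)

swapℕ-suc-self : ∀ k → swapℕ k (suc k) ≡ k
swapℕ-suc-self k = sym (swapℕ-cancel k (swapℕ-self k))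

swapℕ-<-mono : ∀ k {v w} → ¬ (v ≡ k × w ≡ suc k) → v < w → swapℕ k v < swapℕ k w
swapℕ-<-mono zero    {zero}        {suc zero}    excl _         = ⊥-elim (excl (refl , refl))
swapℕ-<-mono zero    {zero}        {suc (suc w)} _    _         = s≤s (s≤s z≤n)
swapℕ-<-mono zero    {suc zero}    {suc (suc w)} _    _         = s≤s z≤n
swapℕ-<-mono zero    {suc (suc v)} {suc (suc w)} _    v<w       = v<w
swapℕ-<-mono zero    {suc zero}    {suc zero}    _    (s≤s ())
swapℕ-<-mono zero    {suc (suc v)} {suc zero}    _    (s≤s ())
swapℕ-<-mono (suc k) {zero}        {suc w}       _    _         = s≤s z≤n
swapℕ-<-mono (suc k) {suc v}       {suc w}       excl (s≤s v<w) =
  s≤s (swapℕ-<-mono k (λ { (refl , refl) → excl (refl , refl) }) v<w)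

⟨$⟩ʳ-injective : (π : Permutation′ n) {x y : Fin n} → π ⟨$⟩ʳ x ≡ π ⟨$⟩ʳ y → x ≡ y
⟨$⟩ʳ-injective π {x} {y} eq = trans (sym (inverseˡ π)) (trans (cong (π ⟨$⟩ˡ_) eq) (inverseˡ π))

flip-cong : (π σ : Permutation′ n) → π ≈ σ → flip π ≈ flip σ
flip-cong π σ π≈σ y = trans (sym (inverseˡ σ)) (cong (σ ⟨$⟩ˡ_) (trans (sym (π≈σ _)) (inverseʳ π)))

commutes-⟨$⟩ˡ : ∀ {m} {α β : Permutation′ m} → (∀ y → α ⟨$⟩ʳ (β ⟨$⟩ʳ y) ≡ β ⟨$⟩ʳ (α ⟨$⟩ʳ y)) →
                ∀ y → α ⟨$⟩ʳ (β ⟨$⟩ˡ y) ≡ β ⟨$⟩ˡ (α ⟨$⟩ʳ y)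
commutes-⟨$⟩ˡ {α = α} {β} αβ≡βα y = begin
  α ⟨$⟩ʳ (β ⟨$⟩ˡ y)                   ≡⟨ sym (inverseˡ β) ⟩
  β ⟨$⟩ˡ (β ⟨$⟩ʳ (α ⟨$⟩ʳ (β ⟨$⟩ˡ y)))  ≡⟨ cong (β ⟨$⟩ˡ_) (sym (αβ≡βα (β ⟨$⟩ˡ y))) ⟩
  β ⟨$⟩ˡ (α ⟨$⟩ʳ (β ⟨$⟩ʳ (β ⟨$⟩ˡ y)))  ≡⟨ cong (λ z → β ⟨$⟩ˡ (α ⟨$⟩ʳ z)) (inverseʳ β) ⟩
  β ⟨$⟩ˡ (α ⟨$⟩ʳ y)                   ∎
  where open ≡-Reasoning

-- Inversions and the sign

Inversion : Permutation′ n → Fin n × Fin n → Set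
Inversion π p = toℕ (proj₁ p) < toℕ (proj₂ p) × toℕ (π ⟨$⟩ʳ proj₂ p) < toℕ (π ⟨$⟩ʳ proj₁ p)

inversion? : (π : Permutation′ n) → Decidable (Inversion π)
inversion? π p = (toℕ (proj₁ p) ℕ.<? toℕ (proj₂ p)) ×-dec (toℕ (π ⟨$⟩ʳ proj₂ p) ℕ.<? toℕ (π ⟨$⟩ʳ proj₁ p))

pairs : ∀ n → List (Fin n × Fin n)
pairs n = cartesianProduct (allFin n) (allFin n)

inversions-cong : (π σ : Permutation′ n) → π ≈ σ → inversions π ≡ inversions σ
inversions-cong {n} π σ π≈σ =
  cong length (filter-≐ (inversion? π) (inversion? σ) (resp {π} {σ} π≈σ , resp {σ} {π} (λ i → sym (π≈σ i))) (pairs n))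
  where
  resp : {π σ : Permutation′ n} → π ≈ σ → ∀ {p} → Inversion π p → Inversion σ p
  resp {π} {σ} π≈σ {i , j} (i<j , πj<πi) = i<j , subst₂ (λ u v → toℕ u < toℕ v) (π≈σ j) (π≈σ i) πj<πi

inversions-id : inversions (id {n}) ≡ 0
inversions-id {n} = cong length (filter-none (inversion? id) {pairs n} (All.tabulate (λ _ (i<j , j<i) → <-asym i<j j<i)))

-- Only the pair (j , i), carrying the values k+1 and k, changes status under τ k.
inversions-descent : (π : Permutation′ n) {k : ℕ} {i j : Fin n} →
                     toℕ (π ⟨$⟩ʳ i) ≡ k → toℕ (π ⟨$⟩ʳ j) ≡ suc k → toℕ j < toℕ i →
                     inversions π ≡ suc (inversions (π ∘ₚ τ k))
inversions-descent {n} π {k} {i} {j} πi≡k πj≡1+k j<i =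
  length-filter-except (inversion? π) (inversion? σ) (pairs n)
    (cartesianProduct⁺ (allFin⁺ n) (allFin⁺ n)) (∈-cartesianProduct⁺ (∈-allFin j) (∈-allFin i))
    (j<i , subst₂ _<_ (sym πi≡k) (sym πj≡1+k) (n<1+n k))
    (λ (_ , σi<σj) → <-asym (subst₂ _<_ σi≡1+k σj≡k σi<σj) (n<1+n k))
    others
  where
  σ = π ∘ₚ τ k
  k<n : suc k < n
  k<n = subst (_< n) πj≡1+k (toℕ<n (π ⟨$⟩ʳ j))
  σ-value : ∀ x → toℕ (σ ⟨$⟩ʳ x) ≡ swapℕ k (toℕ (π ⟨$⟩ʳ x))
  σ-value x = toℕ-swap k (π ⟨$⟩ʳ x) k<n
  σi≡1+k : toℕ (σ ⟨$⟩ʳ i) ≡ suc k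
  σi≡1+k = trans (σ-value i) (trans (cong (swapℕ k) πi≡k) (swapℕ-self k))
  σj≡k : toℕ (σ ⟨$⟩ʳ j) ≡ k
  σj≡k = trans (σ-value j) (trans (cong (swapℕ k) πj≡1+k) (swapℕ-suc-self k))
  same-value : ∀ {x y} → toℕ (π ⟨$⟩ʳ x) ≡ toℕ (π ⟨$⟩ʳ y) → x ≡ y
  same-value eq = ⟨$⟩ʳ-injective π (toℕ-injective eq)
  others : ∀ {p} → p ≢ (j , i) → Inversion π p ⇔ Inversion σ p
  others {p , q} p,q≢j,i = mk⇔
    (λ (p<q , πq<πp) → p<q , subst₂ _<_ (sym (σ-value q)) (sym (σ-value p))
      (swapℕ-<-mono k (λ (πq≡k , πp≡1+k) →
        p,q≢j,i (cong₂ _,_ (same-value (trans πp≡1+k (sym πj≡1+k))) (same-value (trans πq≡k (sym πi≡k)))))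
        πq<πp))
    (λ (p<q , σq<σp) → p<q , subst₂ _<_ (swapℕ-involutive k _) (swapℕ-involutive k _)
      (swapℕ-<-mono k (λ (σq≡k , σp≡1+k) →
        <-asym j<i (subst₂ _<_
          (cong toℕ (same-value (trans (swapℕ-cancel k σp≡1+k) (trans (swapℕ-suc-self k) (sym πi≡k)))))
          (cong toℕ (same-value (trans (swapℕ-cancel k σq≡k) (trans (swapℕ-self k) (sym πj≡1+k))))) p<q))
        (subst₂ _<_ (σ-value q) (σ-value p) σq<σp)))

sign : Permutation′ n → Parity
sign π = parity (inversions π)

parity-suc : ∀ m → parity (suc m) ≡ parity m ⁻¹
parity-suc m = trans (sym (⁻¹-involutive _)) (cong _⁻¹ (suc-homo-⁻¹ m))

sign-cong : (π σ : Permutation′ n) → π ≈ σ → sign π ≡ sign σ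
sign-cong π σ π≈σ = cong parity (inversions-cong π σ π≈σ)

∘τ-involutive : (π : Permutation′ n) (k : ℕ) → (π ∘ₚ τ k) ∘ₚ τ k ≈ π
∘τ-involutive π k x = swap-involutive k (π ⟨$⟩ʳ x)

sign-∘τ-at : (π : Permutation′ n) {k : ℕ} {i j : Fin n} →
             toℕ (π ⟨$⟩ʳ i) ≡ k → toℕ (π ⟨$⟩ʳ j) ≡ suc k → sign (π ∘ₚ τ k) ≡ sign π ⁻¹
sign-∘τ-at {n} π {k} {i} {j} πi≡k πj≡1+k with <-cmp (toℕ i) (toℕ j)
... | tri< i<j _ _ = begin
  parity (inversions (π ∘ₚ τ k))                 ≡⟨ cong parity (inversions-descent (π ∘ₚ τ k) σj≡k σi≡1+k i<j) ⟩
  parity (suc (inversions ((π ∘ₚ τ k) ∘ₚ τ k)))  ≡⟨ cong (λ m → parity (suc m)) π∘τ∘τ≡π ⟩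
  parity (suc (inversions π))                    ≡⟨ parity-suc (inversions π) ⟩
  sign π ⁻¹                                      ∎
  where
  open ≡-Reasoning
  k<n : suc k < n
  k<n = subst (_< n) πj≡1+k (toℕ<n (π ⟨$⟩ʳ j))
  σi≡1+k : toℕ (swap k (π ⟨$⟩ʳ i)) ≡ suc k
  σi≡1+k = trans (toℕ-swap k _ k<n) (trans (cong (swapℕ k) πi≡k) (swapℕ-self k))
  σj≡k : toℕ (swap k (π ⟨$⟩ʳ j)) ≡ k
  σj≡k = trans (toℕ-swap k _ k<n) (trans (cong (swapℕ k) πj≡1+k) (swapℕ-suc-self k))
  π∘τ∘τ≡π : inversions ((π ∘ₚ τ k) ∘ₚ τ k) ≡ inversions π
  π∘τ∘τ≡π = inversions-cong ((π ∘ₚ τ k) ∘ₚ τ k) π (∘τ-involutive π k)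
... | tri≈ _ i≡j _ = ⊥-elim (<-irrefl k≡1+k (n<1+n k))
  where
  k≡1+k : k ≡ suc k
  k≡1+k = trans (sym πi≡k) (trans (cong (λ x → toℕ (π ⟨$⟩ʳ x)) (toℕ-injective i≡j)) πj≡1+k)
... | tri> _ _ j<i = begin
  sign (π ∘ₚ τ k)                          ≡⟨ sym (⁻¹-involutive (sign (π ∘ₚ τ k))) ⟩
  sign (π ∘ₚ τ k) ⁻¹ ⁻¹                    ≡⟨ cong _⁻¹ (sym (parity-suc (inversions (π ∘ₚ τ k)))) ⟩
  parity (suc (inversions (π ∘ₚ τ k))) ⁻¹  ≡⟨ cong (λ m → parity m ⁻¹) (sym (inversions-descent π πi≡k πj≡1+k j<i)) ⟩
  sign π ⁻¹                                ∎
  where open ≡-Reasoning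

sign-∘τ : (π : Permutation′ n) {k : ℕ} → suc k < n → sign (π ∘ₚ τ k) ≡ sign π ⁻¹
sign-∘τ π {k} k<n = sign-∘τ-at π (value (ℕ.<-trans (n<1+n k) k<n)) (value k<n)
  where
  value : ∀ {v} (v<n : v < _) → toℕ (π ⟨$⟩ʳ (π ⟨$⟩ˡ Fin.fromℕ< v<n)) ≡ v
  value v<n = trans (cong toℕ (inverseʳ π)) (toℕ-fromℕ< v<n)

Below : ℕ → List ℕ → Set
Below n = All (λ k → suc k < n)

τs : List ℕ → Permutation′ n
τs []       = id
τs (k ∷ ks) = τs ks ∘ₚ τ k

sign-∘τs : (π : Permutation′ n) {ks : List ℕ} → Below n ks → sign (π ∘ₚ τs ks) ≡ parity (length ks + inversions π)
sign-∘τs π []                       = refl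
sign-∘τs π {k ∷ ks} (k<n ∷ ks<n) = begin
  sign ((π ∘ₚ τs ks) ∘ₚ τ k)                 ≡⟨ sign-∘τ (π ∘ₚ τs ks) k<n ⟩
  sign (π ∘ₚ τs ks) ⁻¹                       ≡⟨ cong _⁻¹ (sign-∘τs π ks<n) ⟩
  parity (length ks + inversions π) ⁻¹       ≡⟨ sym (parity-suc (length ks + inversions π)) ⟩
  parity (suc (length ks + inversions π))    ∎
  where open ≡-Reasoning

sign-τs : {ks : List ℕ} → Below n ks → sign (τs {n} ks) ≡ parity (length ks)
sign-τs {n} {ks} ks<n = begin
  sign (id {n} ∘ₚ τs ks)                   ≡⟨ sign-∘τs (id {n}) ks<n ⟩
  parity (length ks + inversions (id {n})) ≡⟨ cong (λ m → parity (length ks + m)) (inversions-id {n}) ⟩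
  parity (length ks + 0)                   ≡⟨ cong parity (+-identityʳ (length ks)) ⟩
  parity (length ks)                       ∎
  where open ≡-Reasoning

adjacent-increasing⇒inflationary : ∀ {m} (f : Fin m → Fin n) →
  (∀ x y → toℕ y ≡ suc (toℕ x) → toℕ (f x) < toℕ (f y)) → ∀ x → toℕ x ≤ toℕ (f x)
adjacent-increasing⇒inflationary f inc zero    = z≤n
adjacent-increasing⇒inflationary f inc (suc x) = begin
  suc (toℕ x)                  ≤⟨ s≤s (adjacent-increasing⇒inflationary (λ y → f (inject₁ y)) inc′ x) ⟩
  suc (toℕ (f (inject₁ x)))    ≤⟨ inc (inject₁ x) (suc x) (cong suc (sym (toℕ-inject₁ x))) ⟩
  toℕ (f (suc x))              ∎
  where
  open ℕ.≤-Reasoning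
  inc′ : ∀ y z → toℕ z ≡ suc (toℕ y) → toℕ (f (inject₁ y)) < toℕ (f (inject₁ z))
  inc′ y z z≡1+y = inc (inject₁ y) (inject₁ z) (trans (toℕ-inject₁ z) (trans z≡1+y (cong suc (sym (toℕ-inject₁ y)))))

deflationary⇒≈id : (π : Permutation′ n) → (∀ x → toℕ (π ⟨$⟩ʳ x) ≤ toℕ x) → π ≈ id
deflationary⇒≈id π defl x = fixed (suc (toℕ x)) x ℕ.≤-refl
  where
  fixed : ∀ v y → toℕ y < v → π ⟨$⟩ʳ y ≡ y
  fixed (suc v) y (s≤s y≤v) with toℕ (π ⟨$⟩ʳ y) ℕ.<? toℕ y
  ... | yes πy<y = ⊥-elim (<-irrefl (cong toℕ (⟨$⟩ʳ-injective π (fixed v (π ⟨$⟩ʳ y) (<-≤-trans πy<y y≤v)))) πy<y)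
  ... | no  πy≮y = toℕ-injective (≤-antisym (defl y) (≮⇒≥ πy≮y))

InverseDescent : Permutation′ n → Set
InverseDescent π = ∃₂ λ x y → toℕ y ≡ suc (toℕ x) × toℕ (π ⟨$⟩ˡ y) < toℕ (π ⟨$⟩ˡ x)

inverseDescent? : (π : Permutation′ n) → Dec (InverseDescent π)
inverseDescent? π = any? λ x → any? λ y → (toℕ y ℕ.≟ suc (toℕ x)) ×-dec (toℕ (π ⟨$⟩ˡ y) ℕ.<? toℕ (π ⟨$⟩ˡ x))

no-inverseDescent⇒≈id : (π : Permutation′ n) → ¬ InverseDescent π → π ≈ id
no-inverseDescent⇒≈id π ¬descent = deflationary⇒≈id π λ x →
  subst (λ z → toℕ (π ⟨$⟩ʳ x) ≤ toℕ z) (inverseˡ π)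
        (adjacent-increasing⇒inflationary (π ⟨$⟩ˡ_) increasing (π ⟨$⟩ʳ x))
  where
  increasing : ∀ x y → toℕ y ≡ suc (toℕ x) → toℕ (π ⟨$⟩ˡ x) < toℕ (π ⟨$⟩ˡ y)
  increasing x y y≡1+x with <-cmp (toℕ (π ⟨$⟩ˡ x)) (toℕ (π ⟨$⟩ˡ y))
  ... | tri< lt _ _ = lt
  ... | tri≈ _ eq _ = ⊥-elim (<-irrefl (trans (cong toℕ x≡y) y≡1+x) (n<1+n (toℕ x)))
    where x≡y = trans (sym (inverseʳ π)) (trans (cong (π ⟨$⟩ʳ_) (toℕ-injective eq)) (inverseʳ π))
  ... | tri> _ _ gt = ⊥-elim (¬descent (x , y , y≡1+x , gt))

decompose : (π : Permutation′ n) → ∃ λ ks → Below n ks × π ≈ τs ks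
decompose {n} π = go π (<-wellFounded (inversions π))
  where
  go : (π : Permutation′ n) → Acc _<_ (inversions π) → ∃ λ ks → Below n ks × π ≈ τs ks
  go π (acc smaller) with inverseDescent? π
  ... | no ¬descent = [] , [] , no-inverseDescent⇒≈id π ¬descent
  ... | yes (x , y , y≡1+x , y<x) with go (π ∘ₚ τ (toℕ x)) (smaller fewer)
    where
    fewer : inversions (π ∘ₚ τ (toℕ x)) < inversions π
    fewer = subst (inversions (π ∘ₚ τ (toℕ x)) <_)
                  (sym (inversions-descent π (cong toℕ (inverseʳ π)) (trans (cong toℕ (inverseʳ π)) y≡1+x) y<x))
                  (n<1+n _)
  ...   | ks , ks<n , π∘τ≈τs =
    toℕ x ∷ ks , subst (_< n) y≡1+x (toℕ<n y) ∷ ks<n ,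
    λ z → trans (sym (swap-involutive (toℕ x) (π ⟨$⟩ʳ z))) (cong (swap (toℕ x)) (π∘τ≈τs z))

sign-id : sign (id {n}) ≡ 0ℙ
sign-id {n} = cong parity (inversions-id {n})

sign-∘ : (π σ : Permutation′ n) → sign (π ∘ₚ σ) ≡ sign π ℙ.+ sign σ
sign-∘ π σ with decompose σ
... | ks , ks<n , σ≈τs = begin
  sign (π ∘ₚ σ)                         ≡⟨ sign-cong (π ∘ₚ σ) (π ∘ₚ τs ks) (λ x → σ≈τs (π ⟨$⟩ʳ x)) ⟩
  sign (π ∘ₚ τs ks)                     ≡⟨ sign-∘τs π ks<n ⟩
  parity (length ks + inversions π)     ≡⟨ +-homo-+ (length ks) (inversions π) ⟩
  parity (length ks) ℙ.+ sign π         ≡⟨ ℙ.+-comm (parity (length ks)) (sign π) ⟩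
  sign π ℙ.+ parity (length ks)         ≡⟨ cong (sign π ℙ.+_) σ-sign ⟩
  sign π ℙ.+ sign σ                     ∎
  where
  open ≡-Reasoning
  σ-sign : parity (length ks) ≡ sign σ
  σ-sign = sym (trans (sign-cong σ (τs ks) σ≈τs) (sign-τs ks<n))

sign-flip : (π : Permutation′ n) → sign (flip π) ≡ sign π
sign-flip {n} π = ℙ.+-cancelˡ-≡ (sign π) (sign (flip π)) (sign π) (begin
  sign π ℙ.+ sign (flip π)  ≡⟨ sym (sign-∘ π (flip π)) ⟩
  sign (π ∘ₚ flip π)        ≡⟨ sign-cong (π ∘ₚ flip π) id (λ _ → inverseˡ π) ⟩
  sign (id {n})             ≡⟨ sign-id {n} ⟩
  0ℙ                        ≡⟨ sym (p+p≡0ℙ (sign π)) ⟩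
  sign π ℙ.+ sign π         ∎)
  where open ≡-Reasoning

sign-square : (π : Permutation′ n) → sign (π ∘ₚ π) ≡ 0ℙ
sign-square π = trans (sign-∘ π π) (p+p≡0ℙ (sign π))

%2≡0⇔parity≡0ℙ : ∀ m → m % 2 ≡ 0 ⇔ parity m ≡ 0ℙ
%2≡0⇔parity≡0ℙ m = mk⇔ (to m) (from m)
  where
  to : ∀ m → m % 2 ≡ 0 → parity m ≡ 0ℙ
  to zero          _  = refl
  to (suc (suc m)) eq = to m eq
  from : ∀ m → parity m ≡ 0ℙ → m % 2 ≡ 0
  from zero          _  = refl
  from (suc (suc m)) eq = from m eq

isEven⇔sign≡0ℙ : (π : Permutation′ n) → IsEven π ⇔ sign π ≡ 0ℙ
isEven⇔sign≡0ℙ π = %2≡0⇔parity≡0ℙ (inversions π)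

isEven? : (π : Permutation′ n) → Dec (IsEven π)
isEven? π = inversions π % 2 ℕ.≟ 0

isEven-cong : (π σ : Permutation′ n) → π ≈ σ → IsEven π → IsEven σ
isEven-cong π σ π≈σ = subst (λ k → k % 2 ≡ 0) (inversions-cong π σ π≈σ)

isEven-id : IsEven (id {n})
isEven-id {n} = cong (_% 2) (inversions-id {n})

isEven-∘ : (π σ : Permutation′ n) → IsEven π → IsEven σ → IsEven (π ∘ₚ σ)
isEven-∘ π σ π-even σ-even = Equivalence.from (isEven⇔sign≡0ℙ (π ∘ₚ σ)) (begin
  sign (π ∘ₚ σ)       ≡⟨ sign-∘ π σ ⟩
  sign π ℙ.+ sign σ   ≡⟨ cong₂ ℙ._+_ (sign≡0ℙ π π-even) (sign≡0ℙ σ σ-even) ⟩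
  0ℙ                  ∎)
  where
  open ≡-Reasoning
  sign≡0ℙ = λ π → Equivalence.to (isEven⇔sign≡0ℙ π)

isEven-flip : (π : Permutation′ n) → IsEven π → IsEven (flip π)
isEven-flip π π-even = Equivalence.from (isEven⇔sign≡0ℙ (flip π))
  (trans (sign-flip π) (Equivalence.to (isEven⇔sign≡0ℙ π) π-even))

isEven-square : (π : Permutation′ n) → IsEven (π ∘ₚ π)
isEven-square π = Equivalence.from (isEven⇔sign≡0ℙ (π ∘ₚ π)) (sign-square π)

record IsSubgroup (P : Permutation′ n → Set) : Set where
  field
    ∈-resp-≈ : ∀ {π σ} → π ≈ σ → P π → P σ
    id-∈     : P id
    ∘-∈      : ∀ {π σ} → P π → P σ → P (π ∘ₚ σ)
    flip-∈   : ∀ {π} → P π → P (flip π)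

cycle₃ : ℕ → Permutation′ n
cycle₃ i = τ (suc i) ∘ₚ τ i

module _ {P : Permutation′ n → Set} (P-subgroup : IsSubgroup P)
         (cycle₃-∈ : ∀ i → suc (suc i) < n → P (cycle₃ i)) where
  open IsSubgroup P-subgroup

  private
    τ-pair-up : ∀ i d → suc (i + d) < n → P (τ (i + d) ∘ₚ τ i)
    τ-pair-up i zero    _  = ∈-resp-≈ cancel id-∈
      where
      cancel : id ≈ τ (i + 0) ∘ₚ τ i
      cancel x = sym (trans (cong (λ j → swap i (swap j x)) (+-identityʳ i)) (swap-involutive i x))
    τ-pair-up i (suc d) lt =
      ∈-resp-≈ merge (∘-∈ (τ-pair-up (suc i) d lt′) (cycle₃-∈ i (≤-<-trans (s≤s (s≤s (ℕ.m≤m+n i d))) lt′)))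
      where
      lt′ : suc (suc i + d) < n
      lt′ = subst (λ m → suc m < n) (ℕ.+-suc i d) lt
      merge : (τ (suc i + d) ∘ₚ τ (suc i)) ∘ₚ cycle₃ i ≈ τ (i + suc d) ∘ₚ τ i
      merge x = cong (swap i) (trans (swap-involutive (suc i) _) (cong (λ j → swap j x) (sym (ℕ.+-suc i d))))

    τ-pair : ∀ i j → suc i < n → suc j < n → P (τ j ∘ₚ τ i)
    τ-pair i j i<n j<n with ℕ.≤-total i j
    ... | inj₁ i≤j with d , refl ← ℕ.m≤n⇒∃[o]m+o≡n i≤j = τ-pair-up i d j<n
    ... | inj₂ j≤i with d , refl ← ℕ.m≤n⇒∃[o]m+o≡n j≤i = ∈-resp-≈ (λ _ → refl) (flip-∈ (τ-pair-up j d i<n))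

    τs-∈ : ∀ {ks} → Below n ks → parity (length ks) ≡ 0ℙ → P (τs ks)
    τs-∈ []                           _    = id-∈
    τs-∈ (_ ∷ [])                     ()
    τs-∈ {k₁ ∷ k₂ ∷ _} (k₁<n ∷ k₂<n ∷ ks<n) even = ∘-∈ (τs-∈ ks<n even) (τ-pair k₁ k₂ k₁<n k₂<n)

  isEven⇒∈ : ∀ π → IsEven π → P π
  isEven⇒∈ π π-even with decompose π
  ... | ks , ks<n , π≈τs = ∈-resp-≈ (λ x → sym (π≈τs x)) (τs-∈ ks<n (begin
    parity (length ks) ≡⟨ sym (sign-τs {n} ks<n) ⟩
    sign (τs {n} ks)   ≡⟨ sign-cong (τs ks) π (λ x → sym (π≈τs x)) ⟩
    sign π             ≡⟨ Equivalence.to (isEven⇔sign≡0ℙ π) π-even ⟩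
    0ℙ                 ∎))
    where open ≡-Reasoning

invW : Word → Word
invW []      = []
invW (x ∷ w) = invW w ++ [ invL x ]

invL-involutive : ∀ x → invL (invL x) ≡ x
invL-involutive ρ  = refl
invL-involutive ρ⁻ = refl
invL-involutive ℓ  = refl
invL-involutive ℓ⁻ = refl

conjR₂-invW : ∀ w → conjR₂ (invW w) ≡ invW (conjR₂ w)
conjR₂-invW []      = refl
conjR₂-invW (x ∷ w) = trans (map-++ invL (invW w) [ invL x ]) (cong (_++ [ invL (invL x) ]) (conjR₂-invW w))

≡⇒∼ : ∀ {u v} → u ≡ v → u ∼ v
≡⇒∼ refl = ∼-refl

++-invW-cancel : ∀ u v → (u ++ (invW v ++ v)) ∼ u
++-invW-cancel u []      = ≡⇒∼ (++-identityʳ u)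
++-invW-cancel u (x ∷ v) =
  ∼-trans (≡⇒∼ regroup) (∼-trans (∼-cancel (u ++ invW v) (invL x) v)
    (∼-trans (≡⇒∼ (++-assoc u (invW v) v)) (++-invW-cancel u v)))
  where
  regroup : u ++ ((invW v ++ [ invL x ]) ++ x ∷ v) ≡ (u ++ invW v) ++ invL x ∷ invL (invL x) ∷ v
  regroup = begin
    u ++ ((invW v ++ [ invL x ]) ++ x ∷ v)     ≡⟨ cong (u ++_) (++-assoc (invW v) [ invL x ] (x ∷ v)) ⟩
    u ++ (invW v ++ invL x ∷ x ∷ v)            ≡⟨ sym (++-assoc u (invW v) (invL x ∷ x ∷ v)) ⟩
    (u ++ invW v) ++ invL x ∷ x ∷ v            ≡⟨ cong (λ y → (u ++ invW v) ++ invL x ∷ y ∷ v) (sym (invL-involutive x)) ⟩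
    (u ++ invW v) ++ invL x ∷ invL (invL x) ∷ v ∎
    where open ≡-Reasoning

module Action (a b : Permutation′ n) where

  gen : Letter → Permutation′ n
  gen ρ  = a
  gen ρ⁻ = flip a
  gen ℓ  = b
  gen ℓ⁻ = flip b

  ⟦_⟧ : Word → Permutation′ n
  ⟦ [] ⟧    = id
  ⟦ x ∷ w ⟧ = ⟦ w ⟧ ∘ₚ gen x

  ⟦⟧-++ : ∀ u v → ⟦ u ++ v ⟧ ≈ ⟦ v ⟧ ∘ₚ ⟦ u ⟧
  ⟦⟧-++ []      v y = refl
  ⟦⟧-++ (x ∷ u) v y = cong (gen x ⟨$⟩ʳ_) (⟦⟧-++ u v y)

  gen-invL-inverseˡ : ∀ x y → gen (invL x) ⟨$⟩ʳ (gen x ⟨$⟩ʳ y) ≡ y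
  gen-invL-inverseˡ ρ  _ = inverseˡ a
  gen-invL-inverseˡ ρ⁻ _ = inverseʳ a
  gen-invL-inverseˡ ℓ  _ = inverseˡ b
  gen-invL-inverseˡ ℓ⁻ _ = inverseʳ b

  gen-invL-inverseʳ : ∀ x y → gen x ⟨$⟩ʳ (gen (invL x) ⟨$⟩ʳ y) ≡ y
  gen-invL-inverseʳ ρ  _ = inverseʳ a
  gen-invL-inverseʳ ρ⁻ _ = inverseˡ a
  gen-invL-inverseʳ ℓ  _ = inverseʳ b
  gen-invL-inverseʳ ℓ⁻ _ = inverseˡ b

  ⟦invW⟧-inverseˡ : ∀ w y → ⟦ invW w ⟧ ⟨$⟩ʳ (⟦ w ⟧ ⟨$⟩ʳ y) ≡ y
  ⟦invW⟧-inverseˡ []      y = refl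
  ⟦invW⟧-inverseˡ (x ∷ w) y = begin
    ⟦ invW w ++ [ invL x ] ⟧ ⟨$⟩ʳ (gen x ⟨$⟩ʳ (⟦ w ⟧ ⟨$⟩ʳ y))          ≡⟨ ⟦⟧-++ (invW w) [ invL x ] _ ⟩
    ⟦ invW w ⟧ ⟨$⟩ʳ (gen (invL x) ⟨$⟩ʳ (gen x ⟨$⟩ʳ (⟦ w ⟧ ⟨$⟩ʳ y)))  ≡⟨ cong (⟦ invW w ⟧ ⟨$⟩ʳ_) (gen-invL-inverseˡ x _) ⟩
    ⟦ invW w ⟧ ⟨$⟩ʳ (⟦ w ⟧ ⟨$⟩ʳ y)                                    ≡⟨ ⟦invW⟧-inverseˡ w y ⟩
    y                                                                 ∎
    where open ≡-Reasoning

  ⟦invW⟧ : ∀ w → ⟦ invW w ⟧ ≈ flip ⟦ w ⟧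
  ⟦invW⟧ w y = trans (cong (⟦ invW w ⟧ ⟨$⟩ʳ_) (sym (inverseʳ ⟦ w ⟧))) (⟦invW⟧-inverseˡ w (⟦ w ⟧ ⟨$⟩ˡ y))

  -- w ∈ H^r iff conjR₂ w ∈ H, i.e. iff ⟦ conjR₂ w ⟧ is trivial: this is the image of H^r in
  -- Mon ≅ A_n, the chirality group.
  InChiralityGroup : Permutation′ n → Set
  InChiralityGroup π = ∃ λ w → ⟦ w ⟧ ≈ π × ⟦ conjR₂ w ⟧ ≈ id

  chiralityGroup-isSubgroup : IsSubgroup InChiralityGroup
  chiralityGroup-isSubgroup = record
    { ∈-resp-≈ = λ π≈σ (w , ⟦w⟧≈π , r) → w , (λ x → trans (⟦w⟧≈π x) (π≈σ x)) , r
    ; id-∈     = [] , (λ _ → refl) , (λ _ → refl)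
    ; ∘-∈      = λ {π} {σ} → ∘-∈ {π} {σ}
    ; flip-∈   = λ {π} → flip-∈ {π}
    }
    where
    flip-∈ : ∀ {π} → InChiralityGroup π → InChiralityGroup (flip π)
    flip-∈ {π} (w , ⟦w⟧≈π , r) = invW w
      , (λ x → trans (⟦invW⟧ w x) (flip-cong ⟦ w ⟧ π ⟦w⟧≈π x))
      , (λ x → trans (cong (λ u → ⟦ u ⟧ ⟨$⟩ʳ x) (conjR₂-invW w))
                (trans (⟦invW⟧ (conjR₂ w) x) (flip-cong ⟦ conjR₂ w ⟧ id r x)))
    ∘-∈ : ∀ {π σ} → InChiralityGroup π → InChiralityGroup σ → InChiralityGroup (π ∘ₚ σ)
    ∘-∈ {π} {σ} (u , ⟦u⟧≈π , ru) (v , ⟦v⟧≈σ , rv) = v ++ u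
      , (λ x → trans (⟦⟧-++ v u x) (trans (cong (⟦ v ⟧ ⟨$⟩ʳ_) (⟦u⟧≈π x)) (⟦v⟧≈σ _)))
      , (λ x → trans (cong (λ w → ⟦ w ⟧ ⟨$⟩ʳ x) (map-++ invL v u))
                (trans (⟦⟧-++ (conjR₂ v) (conjR₂ u) x) (trans (cong (⟦ conjR₂ v ⟧ ⟨$⟩ʳ_) (ru x)) (rv x))))

  inChiralityGroup-by-evaluation : ∀ π w → {True (all? λ x → ⟦ w ⟧ ⟨$⟩ʳ x ≟ π ⟨$⟩ʳ x)} →
                                   {True (all? λ x → ⟦ conjR₂ w ⟧ ⟨$⟩ʳ x ≟ x)} → InChiralityGroup π
  inChiralityGroup-by-evaluation π w {⟦w⟧≈π} {⟦w̄⟧≈id} = w , toWitness ⟦w⟧≈π , toWitness ⟦w̄⟧≈id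

  conj-b-∈ : ∀ {π} → InChiralityGroup π → InChiralityGroup (flip b ∘ₚ π ∘ₚ b)
  conj-b-∈ (w , ⟦w⟧≈π , r) = ℓ ∷ w ++ [ ℓ⁻ ]
    , (λ x → cong (b ⟨$⟩ʳ_) (trans (⟦⟧-++ w [ ℓ⁻ ] x) (⟦w⟧≈π _)))
    , (λ x → trans (cong (λ u → flip b ⟨$⟩ʳ (⟦ u ⟧ ⟨$⟩ʳ x)) (map-++ invL w [ ℓ⁻ ]))
        (trans (cong (flip b ⟨$⟩ʳ_) (trans (⟦⟧-++ (conjR₂ w) [ ℓ ] x) (r _))) (inverseˡ b)))

  module _ (b-shift : ∀ j → suc (suc (suc j)) < n → ∀ x → b ⟨$⟩ʳ (swap j x) ≡ swap (suc (suc j)) (b ⟨$⟩ʳ x))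
           (cycle₃-0 : InChiralityGroup (cycle₃ 0)) (cycle₃-1 : InChiralityGroup (cycle₃ 1)) where
    open IsSubgroup chiralityGroup-isSubgroup

    cycle₃-∈ : ∀ i → suc (suc i) < n → InChiralityGroup (cycle₃ i)
    cycle₃-∈ zero          _  = cycle₃-0
    cycle₃-∈ (suc zero)    _  = cycle₃-1
    cycle₃-∈ (suc (suc i)) lt =
      ∈-resp-≈ {flip b ∘ₚ cycle₃ i ∘ₚ b} {cycle₃ (suc (suc i))} shift (conj-b-∈ {cycle₃ i} (cycle₃-∈ i i<n))
      where
      i<n : suc (suc i) < n
      i<n = ℕ.<-trans (n<1+n _) (ℕ.<-trans (n<1+n _) lt)
      shift : flip b ∘ₚ cycle₃ i ∘ₚ b ≈ cycle₃ (suc (suc i))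
      shift x = begin
        b ⟨$⟩ʳ (swap i (swap (1 + i) (b ⟨$⟩ˡ x)))       ≡⟨ b-shift i (ℕ.<-trans (n<1+n _) lt) _ ⟩
        swap (2 + i) (b ⟨$⟩ʳ (swap (1 + i) (b ⟨$⟩ˡ x)))  ≡⟨ cong (swap (2 + i)) (b-shift (suc i) lt _) ⟩
        swap (2 + i) (swap (3 + i) (b ⟨$⟩ʳ (b ⟨$⟩ˡ x)))  ≡⟨ cong (λ y → swap (2 + i) (swap (3 + i) y)) (inverseʳ b) ⟩
        swap (2 + i) (swap (3 + i) x)                    ∎
        where open ≡-Reasoning

    isEven⇒inChiralityGroup : ∀ π → IsEven π → InChiralityGroup π
    isEven⇒inChiralityGroup = isEven⇒∈ chiralityGroup-isSubgroup cycle₃-∈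

module _ (H : Hypermap) where
  open Hypermap H
  open Action R L

  act-⟦⟧ : ∀ w d → act H w d ≡ ⟦ w ⟧ ⟨$⟩ʳ d
  act-⟦⟧ []       d = refl
  act-⟦⟧ (ρ  ∷ w) d = cong (R ⟨$⟩ʳ_) (act-⟦⟧ w d)
  act-⟦⟧ (ρ⁻ ∷ w) d = cong (R ⟨$⟩ˡ_) (act-⟦⟧ w d)
  act-⟦⟧ (ℓ  ∷ w) d = cong (L ⟨$⟩ʳ_) (act-⟦⟧ w d)
  act-⟦⟧ (ℓ⁻ ∷ w) d = cong (L ⟨$⟩ˡ_) (act-⟦⟧ w d)

  aut-actL : ∀ α → IsAut H α → ∀ x d → α ⟨$⟩ʳ actL H x d ≡ actL H x (α ⟨$⟩ʳ d)
  aut-actL α α-aut ρ  d = proj₁ (α-aut d)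
  aut-actL α α-aut ℓ  d = proj₂ (α-aut d)
  aut-actL α α-aut ρ⁻ d = commutes-⟨$⟩ˡ {α = α} {R} (λ e → proj₁ (α-aut e)) d
  aut-actL α α-aut ℓ⁻ d = commutes-⟨$⟩ˡ {α = α} {L} (λ e → proj₂ (α-aut e)) d

  aut-act : ∀ α → IsAut H α → ∀ w d → α ⟨$⟩ʳ act H w d ≡ act H w (α ⟨$⟩ʳ d)
  aut-act α α-aut []      d = refl
  aut-act α α-aut (x ∷ w) d = trans (aut-actL α α-aut x (act H w d)) (cong (actL H x) (aut-act α α-aut w d))

  transitive∧aut-fixes⇒id : Transitive H → ∀ α → IsAut H α → ∀ d → α ⟨$⟩ʳ d ≡ d → ∀ e → α ⟨$⟩ʳ e ≡ e
  transitive∧aut-fixes⇒id trans-H α α-aut d αd≡d e = begin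
    α ⟨$⟩ʳ e                   ≡⟨ cong (α ⟨$⟩ʳ_) (sym (proj₂ (trans-H d e))) ⟩
    α ⟨$⟩ʳ act H w d           ≡⟨ aut-act α α-aut w d ⟩
    act H w (α ⟨$⟩ʳ d)         ≡⟨ cong (act H w) αd≡d ⟩
    act H w d                  ≡⟨ proj₂ (trans-H d e) ⟩
    e                          ∎
    where
    open ≡-Reasoning
    w = proj₁ (trans-H d e)

  totallyChiral-intro : (∀ w → ∃ λ v → InHr H v × (∀ d → act H v d ≡ act H w d)) → TotallyChiral H
  totallyChiral-intro H^r-meets w = w ++ invW v , v , w·v⁻¹∈H , v∈H^r , ∼-sym cancel
    where
    v = proj₁ (H^r-meets w)
    v∈H^r = proj₁ (proj₂ (H^r-meets w))
    v≡w = proj₂ (proj₂ (H^r-meets w))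
    cancel = ∼-trans (≡⇒∼ (++-assoc w (invW v) v)) (++-invW-cancel w v)
    w·v⁻¹∈H : InH H (w ++ invW v)
    w·v⁻¹∈H d = begin
      act H (w ++ invW v) d                ≡⟨ act-⟦⟧ (w ++ invW v) d ⟩
      ⟦ w ++ invW v ⟧ ⟨$⟩ʳ d               ≡⟨ ⟦⟧-++ w (invW v) d ⟩
      ⟦ w ⟧ ⟨$⟩ʳ (⟦ invW v ⟧ ⟨$⟩ʳ d)       ≡⟨ sym (act-⟦⟧ w _) ⟩
      act H w (⟦ invW v ⟧ ⟨$⟩ʳ d)          ≡⟨ sym (v≡w _) ⟩
      act H v (⟦ invW v ⟧ ⟨$⟩ʳ d)          ≡⟨ act-⟦⟧ v _ ⟩
      ⟦ v ⟧ ⟨$⟩ʳ (⟦ invW v ⟧ ⟨$⟩ʳ d)       ≡⟨ cong (⟦ v ⟧ ⟨$⟩ʳ_) (⟦invW⟧ v d) ⟩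
      ⟦ v ⟧ ⟨$⟩ʳ (⟦ v ⟧ ⟨$⟩ˡ d)            ≡⟨ inverseʳ ⟦ v ⟧ ⟩
      d                                    ∎
      where open ≡-Reasoning

-- An enumeration of A_n

module Enumeration (n : ℕ) where

  vectors : ∀ k → List (Vec (Fin n) k)
  vectors zero    = [ [] ]
  vectors (suc k) = cartesianProductWith _∷_ (allFin n) (vectors k)

  ∈-vectors : ∀ {k} (v : Vec (Fin n) k) → v ∈ vectors k
  ∈-vectors []      = here refl
  ∈-vectors (x ∷ v) = ∈-cartesianProductWith⁺ _∷_ (∈-allFin x) (∈-vectors v)

  vectors-unique : ∀ k → Unique (vectors k)
  vectors-unique zero    = [] ∷ []
  vectors-unique (suc k) = cartesianProductWith⁺ _∷_ ∷-injective (allFin⁺ n) (vectors-unique k)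

  IsBijective : Vec (Fin n) n → Set
  IsBijective t = (∀ i j → Vec.lookup t i ≡ Vec.lookup t j → i ≡ j) × (∀ y → ∃ λ x → Vec.lookup t x ≡ y)

  isBijective? : Decidable IsBijective
  isBijective? t = all? (λ i → all? λ j → (Vec.lookup t i ≟ Vec.lookup t j) →-dec (i ≟ j))
           ×-dec all? (λ y → any? λ x → Vec.lookup t x ≟ y)

  toPermutation : ∀ t → IsBijective t → Permutation′ n
  toPermutation t (inj , surj) = permutation (Vec.lookup t) (λ y → proj₁ (surj y))
    (λ y → proj₂ (surj y)) (λ x → inj _ x (proj₂ (surj (Vec.lookup t x))))

  IsEvenTable : Vec (Fin n) n → Set
  IsEvenTable t = Σ (IsBijective t) λ bij → IsEven (toPermutation t bij)

  -- The evenness of toPermutation t bij does not depend on the proof bij.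
  isEvenTable? : Decidable IsEvenTable
  isEvenTable? t with isBijective? t
  ... | no ¬bij = no λ (bij , _) → ¬bij bij
  ... | yes bij with isEven? (toPermutation t bij)
  ...   | yes even = yes (bij , even)
  ...   | no ¬even = no λ (_ , even) → ¬even even

  evenTables : List (Vec (Fin n) n)
  evenTables = filter isEvenTable? (vectors n)

  order : ℕ
  order = length evenTables

  isEvenTable-lookup : ∀ d → IsEvenTable (lookup evenTables d)
  isEvenTable-lookup d = proj₂ (∈-filter⁻ isEvenTable? {xs = vectors n} (∈-lookup d))

  perm : Fin order → Permutation′ n
  perm d = toPermutation (lookup evenTables d) (proj₁ (isEvenTable-lookup d))

  perm-isEven : ∀ d → IsEven (perm d)
  perm-isEven d = proj₂ (isEvenTable-lookup d)

  perm-injective : ∀ {d e} → perm d ≈ perm e → d ≡ e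
  perm-injective {d} {e} d≈e = Unique⇒lookup-injective (filter⁺ isEvenTable? (vectors-unique n)) (begin
    lookup evenTables d                            ≡⟨ sym (tabulate∘lookup (lookup evenTables d)) ⟩
    tabulate (Vec.lookup (lookup evenTables d))    ≡⟨ tabulate-cong d≈e ⟩
    tabulate (Vec.lookup (lookup evenTables e))    ≡⟨ tabulate∘lookup (lookup evenTables e) ⟩
    lookup evenTables e                            ∎)
    where open ≡-Reasoning

  -- The evenness proof is irrelevant (recomputed below), so that darts obtained from different
  -- proofs are definitionally equal.
  module _ (π : Permutation′ n) .(π-even : IsEven π) where

    private
      table = tabulate (π ⟨$⟩ʳ_)
      table-bij : IsBijective table
      table-bij = (λ i j eq → ⟨$⟩ʳ-injective π (trans (sym (lookup∘tabulate _ i)) (trans eq (lookup∘tabulate _ j))))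
                , (λ y → π ⟨$⟩ˡ y , trans (lookup∘tabulate (π ⟨$⟩ʳ_) (π ⟨$⟩ˡ y)) (inverseʳ π))
      table∈ : table ∈ evenTables
      table∈ = ∈-filter⁺ isEvenTable? (∈-vectors table) (table-bij ,
        isEven-cong π (toPermutation table table-bij) (λ i → sym (lookup∘tabulate _ i)) (recompute (isEven? π) π-even))

    dart : Fin order
    dart = Any.index table∈

    perm-dart : perm dart ≈ π
    perm-dart i = trans (cong (λ t → Vec.lookup t i) (sym (lookup-index table∈))) (lookup∘tabulate _ i)

-- The regular hypermap with monodromy group A_n

module RegularHypermap (a b : Permutation′ n) (a-even : IsEven a) (b-even : IsEven b)
                       (chiral : ∀ π → IsEven π → Action.InChiralityGroup a b π) where
  open Action a b
  open Enumeration n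

  gen-isEven : ∀ x → IsEven (gen x)
  gen-isEven ρ  = a-even
  gen-isEven ρ⁻ = isEven-flip a a-even
  gen-isEven ℓ  = b-even
  gen-isEven ℓ⁻ = isEven-flip b b-even

  ⟦⟧-isEven : ∀ w → IsEven ⟦ w ⟧
  ⟦⟧-isEven []      = isEven-id {n}
  ⟦⟧-isEven (x ∷ w) = isEven-∘ ⟦ w ⟧ (gen x) (⟦⟧-isEven w) (gen-isEven x)

  left-isEven : ∀ x d → IsEven (perm d ∘ₚ gen x)
  left-isEven x d = isEven-∘ (perm d) (gen x) (perm-isEven d) (gen-isEven x)

  left : Letter → Fin order → Fin order
  left x d = dart (perm d ∘ₚ gen x) (left-isEven x d)

  perm-left : ∀ x d → perm (left x d) ≈ perm d ∘ₚ gen x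
  perm-left x d = perm-dart (perm d ∘ₚ gen x) (left-isEven x d)

  left-invL-inverseˡ : ∀ x d → left (invL x) (left x d) ≡ d
  left-invL-inverseˡ x d = perm-injective λ y → trans (perm-left (invL x) (left x d) y)
    (trans (cong (gen (invL x) ⟨$⟩ʳ_) (perm-left x d y)) (gen-invL-inverseˡ x (perm d ⟨$⟩ʳ y)))

  left-invL-inverseʳ : ∀ x d → left x (left (invL x) d) ≡ d
  left-invL-inverseʳ x d = perm-injective λ y → trans (perm-left x (left (invL x) d) y)
    (trans (cong (gen x ⟨$⟩ʳ_) (perm-left (invL x) d y)) (gen-invL-inverseʳ x (perm d ⟨$⟩ʳ y)))

  generator : Letter → Permutation′ order
  generator x = permutation (left x) (left (invL x)) (left-invL-inverseʳ x) (left-invL-inverseˡ x)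

  hypermap : Hypermap
  hypermap = record { m = order ; R = generator ρ ; L = generator ℓ }

  actL-left : ∀ x d → actL hypermap x d ≡ left x d
  actL-left ρ  _ = refl
  actL-left ρ⁻ _ = refl
  actL-left ℓ  _ = refl
  actL-left ℓ⁻ _ = refl

  perm-act : ∀ w d → perm (act hypermap w d) ≈ perm d ∘ₚ ⟦ w ⟧
  perm-act []      d y = refl
  perm-act (x ∷ w) d y = begin
    perm (actL hypermap x (act hypermap w d)) ⟨$⟩ʳ y   ≡⟨ cong (λ e → perm e ⟨$⟩ʳ y) (actL-left x (act hypermap w d)) ⟩
    perm (left x (act hypermap w d)) ⟨$⟩ʳ y            ≡⟨ perm-left x (act hypermap w d) y ⟩
    gen x ⟨$⟩ʳ (perm (act hypermap w d) ⟨$⟩ʳ y)        ≡⟨ cong (gen x ⟨$⟩ʳ_) (perm-act w d y) ⟩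
    gen x ⟨$⟩ʳ (⟦ w ⟧ ⟨$⟩ʳ (perm d ⟨$⟩ʳ y))            ∎
    where open ≡-Reasoning

  ⟦⟧-≈⇒act-≡ : ∀ u v → ⟦ u ⟧ ≈ ⟦ v ⟧ → ∀ d → act hypermap u d ≡ act hypermap v d
  ⟦⟧-≈⇒act-≡ u v u≈v d = perm-injective λ y →
    trans (perm-act u d y) (trans (u≈v (perm d ⟨$⟩ʳ y)) (sym (perm-act v d y)))

  act-≡⇒⟦⟧-≈ : ∀ u v → (∀ d → act hypermap u d ≡ act hypermap v d) → ⟦ u ⟧ ≈ ⟦ v ⟧
  act-≡⇒⟦⟧-≈ u v u≡v y = begin
    ⟦ u ⟧ ⟨$⟩ʳ y                    ≡⟨ cong (⟦ u ⟧ ⟨$⟩ʳ_) (sym (perm-dart id (isEven-id {n}) y)) ⟩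
    ⟦ u ⟧ ⟨$⟩ʳ (perm d₀ ⟨$⟩ʳ y)     ≡⟨ sym (perm-act u d₀ y) ⟩
    perm (act hypermap u d₀) ⟨$⟩ʳ y ≡⟨ cong (λ e → perm e ⟨$⟩ʳ y) (u≡v d₀) ⟩
    perm (act hypermap v d₀) ⟨$⟩ʳ y ≡⟨ perm-act v d₀ y ⟩
    ⟦ v ⟧ ⟨$⟩ʳ (perm d₀ ⟨$⟩ʳ y)     ≡⟨ cong (⟦ v ⟧ ⟨$⟩ʳ_) (perm-dart id (isEven-id {n}) y) ⟩
    ⟦ v ⟧ ⟨$⟩ʳ y                    ∎
    where
    open ≡-Reasoning
    d₀ = dart id (isEven-id {n})

  transitive : Transitive hypermap
  transitive d e = w , perm-injective λ y →
    trans (perm-act w d y) (trans (⟦w⟧≈π (perm d ⟨$⟩ʳ y)) (cong (perm e ⟨$⟩ʳ_) (inverseˡ (perm d))))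
    where
    π = flip (perm d) ∘ₚ perm e
    π-rep = chiral π (isEven-∘ (flip (perm d)) (perm e) (isEven-flip (perm d) (perm-isEven d)) (perm-isEven e))
    w = proj₁ π-rep
    ⟦w⟧≈π = proj₁ (proj₂ π-rep)

  right-isEven : ∀ σ → IsEven σ → ∀ d → IsEven (σ ∘ₚ perm d)
  right-isEven σ σ-even d = isEven-∘ σ (perm d) σ-even (perm-isEven d)

  right : (σ : Permutation′ n) → IsEven σ → Fin order → Fin order
  right σ σ-even d = dart (σ ∘ₚ perm d) (right-isEven σ σ-even d)

  perm-right : ∀ σ σ-even d → perm (right σ σ-even d) ≈ σ ∘ₚ perm d
  perm-right σ σ-even d = perm-dart (σ ∘ₚ perm d) (right-isEven σ σ-even d)

  right-left : ∀ σ σ-even x d → right σ σ-even (left x d) ≡ left x (right σ σ-even d)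
  right-left σ σ-even x d = perm-injective λ y → begin
    perm (right σ σ-even (left x d)) ⟨$⟩ʳ y  ≡⟨ perm-right σ σ-even (left x d) y ⟩
    perm (left x d) ⟨$⟩ʳ (σ ⟨$⟩ʳ y)          ≡⟨ perm-left x d (σ ⟨$⟩ʳ y) ⟩
    gen x ⟨$⟩ʳ (perm d ⟨$⟩ʳ (σ ⟨$⟩ʳ y))      ≡⟨ cong (gen x ⟨$⟩ʳ_) (sym (perm-right σ σ-even d y)) ⟩
    gen x ⟨$⟩ʳ (perm (right σ σ-even d) ⟨$⟩ʳ y) ≡⟨ sym (perm-left x (right σ σ-even d) y) ⟩
    perm (left x (right σ σ-even d)) ⟨$⟩ʳ y  ∎
    where open ≡-Reasoning

  right-inverse : ∀ σ σ-even σ′ σ′-even → (∀ y → σ ⟨$⟩ʳ (σ′ ⟨$⟩ʳ y) ≡ y) →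
                  ∀ d → right σ′ σ′-even (right σ σ-even d) ≡ d
  right-inverse σ σ-even σ′ σ′-even σσ′≡id d = perm-injective λ y →
    trans (perm-right σ′ σ′-even (right σ σ-even d) y)
          (trans (perm-right σ σ-even d (σ′ ⟨$⟩ʳ y)) (cong (perm d ⟨$⟩ʳ_) (σσ′≡id y)))

  rightPerm : (σ : Permutation′ n) → IsEven σ → Permutation′ order
  rightPerm σ σ-even = permutation (right σ σ-even) (right (flip σ) σ⁻¹-even)
    (right-inverse (flip σ) σ⁻¹-even σ σ-even (λ _ → inverseˡ σ))
    (right-inverse σ σ-even (flip σ) σ⁻¹-even (λ _ → inverseʳ σ))
    where σ⁻¹-even = isEven-flip σ σ-even

  rightPerm-isAut : ∀ σ σ-even → IsAut hypermap (rightPerm σ σ-even)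
  rightPerm-isAut σ σ-even d = right-left σ σ-even ρ d , right-left σ σ-even ℓ d

  orientablyRegular : OrientablyRegular hypermap
  orientablyRegular = aut-transitive , transitive∧aut-fixes⇒id hypermap transitive
    where
    aut-transitive : ∀ d e → ∃ λ α → IsAut hypermap α × (α ⟨$⟩ʳ d ≡ e)
    aut-transitive d e = rightPerm σ σ-even , rightPerm-isAut σ σ-even , perm-injective λ y →
      trans (perm-right σ σ-even d y) (inverseʳ (perm d))
      where
      σ = perm e ∘ₚ flip (perm d)
      σ-even = isEven-∘ (perm e) (flip (perm d)) (perm-isEven e) (isEven-flip (perm d) (perm-isEven d))

  totallyChiral : TotallyChiral hypermap
  totallyChiral = totallyChiral-intro hypermap λ w →
    let v , ⟦v⟧≈⟦w⟧ , v∈H^r = chiral ⟦ w ⟧ (⟦⟧-isEven w)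
    in v , ⟦⟧-≈⇒act-≡ (conjR₂ v) [] v∈H^r , ⟦⟧-≈⇒act-≡ v w ⟦v⟧≈⟦w⟧

  monIsoAlt : MonIsoAlt hypermap n
  monIsoAlt = ⟦_⟧ , act-≡⇒⟦⟧-≈ , ⟦⟧-≈⇒act-≡ , ⟦⟧-++ , ⟦⟧-isEven , λ π π-even →
    let w , ⟦w⟧≈π , _ = chiral π π-even in w , ⟦w⟧≈π

fiveCycleᶠ : ∀ {k} → Fin (5 + k) → Fin (5 + k)
fiveCycleᶠ 0F = 1F
fiveCycleᶠ 1F = 2F
fiveCycleᶠ 2F = 4F
fiveCycleᶠ 3F = 0F
fiveCycleᶠ 4F = 3F
fiveCycleᶠ (suc (suc (suc (suc (suc x))))) = suc (suc (suc (suc (suc x))))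

fiveCycleᶠ⁻¹ : ∀ {k} → Fin (5 + k) → Fin (5 + k)
fiveCycleᶠ⁻¹ 0F = 3F
fiveCycleᶠ⁻¹ 1F = 0F
fiveCycleᶠ⁻¹ 2F = 1F
fiveCycleᶠ⁻¹ 3F = 4F
fiveCycleᶠ⁻¹ 4F = 2F
fiveCycleᶠ⁻¹ (suc (suc (suc (suc (suc x))))) = suc (suc (suc (suc (suc x))))

fiveCycle : ∀ {k} → Permutation′ (5 + k)
fiveCycle = permutation fiveCycleᶠ fiveCycleᶠ⁻¹ inverse₁ inverse₂
  where
  inverse₁ : ∀ x → fiveCycleᶠ (fiveCycleᶠ⁻¹ x) ≡ x
  inverse₁ 0F = refl
  inverse₁ 1F = refl
  inverse₁ 2F = refl
  inverse₁ 3F = refl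
  inverse₁ 4F = refl
  inverse₁ (suc (suc (suc (suc (suc x))))) = refl
  inverse₂ : ∀ x → fiveCycleᶠ⁻¹ (fiveCycleᶠ x) ≡ x
  inverse₂ 0F = refl
  inverse₂ 1F = refl
  inverse₂ 2F = refl
  inverse₂ 3F = refl
  inverse₂ 4F = refl
  inverse₂ (suc (suc (suc (suc (suc x))))) = refl

-- A 5-cycle is the square of its cube.
fiveCycle-isEven : ∀ {k} → IsEven (fiveCycle {k})
fiveCycle-isEven {k} = isEven-cong (cube ∘ₚ cube) fiveCycle square≈ (isEven-square cube)
  where
  cube = fiveCycle {k} ∘ₚ fiveCycle ∘ₚ fiveCycle
  square≈ : cube ∘ₚ cube ≈ fiveCycle {k}
  square≈ 0F = refl
  square≈ 1F = refl
  square≈ 2F = refl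
  square≈ 3F = refl
  square≈ 4F = refl
  square≈ (suc (suc (suc (suc (suc x))))) = refl

-- x ↦ x + 1 modulo n
rotation : Permutation′ n
rotation {zero}        = id
rotation {suc zero}    = id
rotation {suc (suc n)} = lift₀ rotation ∘ₚ τ 0

swap₀-swap₂₊-comm : ∀ i (y : Fin n) → swap 0 (swap (suc (suc i)) y) ≡ swap (suc (suc i)) (swap 0 y)
swap₀-swap₂₊-comm i (zero {zero})  = refl
swap₀-swap₂₊-comm i (zero {suc _}) = refl
swap₀-swap₂₊-comm i 1F             = refl
swap₀-swap₂₊-comm i (suc (suc y))  = refl

swap-braid : (x : Fin (3 + n)) → swap 0 (swap 1 (swap 0 x)) ≡ swap 1 (swap 0 (swap 1 x))
swap-braid 0F = refl
swap-braid 1F = refl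
swap-braid 2F = refl
swap-braid (suc (suc (suc x))) = refl

rotation-unfold : (x : Fin (3 + n)) → rotation ⟨$⟩ʳ x ≡ swap 0 (swap 1 (lift₀ (lift₀ rotation) ⟨$⟩ʳ x))
rotation-unfold zero    = refl
rotation-unfold (suc x) = refl

lift₀₂-swap₀ : (π : Permutation′ n) (x : Fin (2 + n)) →
               lift₀ (lift₀ π) ⟨$⟩ʳ (swap 0 x) ≡ swap 0 (lift₀ (lift₀ π) ⟨$⟩ʳ x)
lift₀₂-swap₀ π 0F = refl
lift₀₂-swap₀ π 1F = refl
lift₀₂-swap₀ π (suc (suc x)) = refl

rotation-swap : ∀ j → suc (suc j) < n → (x : Fin n) → rotation ⟨$⟩ʳ (swap j x) ≡ swap (suc j) (rotation ⟨$⟩ʳ x)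
rotation-swap {suc zero}          _       (s≤s ())
rotation-swap {suc (suc zero)}    zero    (s≤s (s≤s ()))
rotation-swap {suc (suc (suc n))} zero _ x = begin
  rotation ⟨$⟩ʳ (swap 0 x)                       ≡⟨ rotation-unfold (swap 0 x) ⟩
  swap 0 (swap 1 (L ⟨$⟩ʳ (swap 0 x)))            ≡⟨ cong (λ y → swap 0 (swap 1 y)) (lift₀₂-swap₀ rotation x) ⟩
  swap 0 (swap 1 (swap 0 (L ⟨$⟩ʳ x)))            ≡⟨ swap-braid (L ⟨$⟩ʳ x) ⟩
  swap 1 (swap 0 (swap 1 (L ⟨$⟩ʳ x)))            ≡⟨ cong (swap 1) (sym (rotation-unfold x)) ⟩
  swap 1 (rotation ⟨$⟩ʳ x)                       ∎
  where
  open ≡-Reasoning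
  L = lift₀ (lift₀ (rotation {suc n}))
rotation-swap {suc (suc n)} (suc j) _         zero    = refl
rotation-swap {suc (suc n)} (suc j) (s≤s lt)  (suc x) = begin
  swap 0 (suc (rotation ⟨$⟩ʳ (swap j x)))                 ≡⟨ cong (λ y → swap 0 (suc y)) (rotation-swap j lt x) ⟩
  swap 0 (swap (suc (suc j)) (suc (rotation ⟨$⟩ʳ x)))     ≡⟨ swap₀-swap₂₊-comm j (suc (rotation ⟨$⟩ʳ x)) ⟩
  swap (suc (suc j)) (swap 0 (suc (rotation ⟨$⟩ʳ x)))     ∎
  where open ≡-Reasoning

TotallyChiralAlternating : ℕ → Set
TotallyChiralAlternating n =
  ∃ λ (H : Hypermap) → Transitive H × OrientablyRegular H × TotallyChiral H × MonIsoAlt H n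

module Generators (m : ℕ) where

  b-shift : ∀ j → suc (suc (suc j)) < 5 + m → ∀ x →
            (rotation ∘ₚ rotation) ⟨$⟩ʳ (swap j x) ≡ swap (suc (suc j)) ((rotation ∘ₚ rotation) ⟨$⟩ʳ x)
  b-shift j lt x = trans (cong (rotation ⟨$⟩ʳ_) (rotation-swap j (ℕ.<-trans (n<1+n _) lt) x))
                         (rotation-swap (suc j) lt (rotation ⟨$⟩ʳ x))

  open Action (fiveCycle {m}) (rotation ∘ₚ rotation) public

  module _ (cycle₃-0 : InChiralityGroup (cycle₃ 0)) (cycle₃-1 : InChiralityGroup (cycle₃ 1)) where

    open RegularHypermap (fiveCycle {m}) (rotation ∘ₚ rotation)
                         (fiveCycle-isEven {m}) (isEven-square (rotation {5 + m}))
                         (isEven⇒inChiralityGroup b-shift cycle₃-0 cycle₃-1)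

    totallyChiralAlternating : TotallyChiralAlternating (5 + m)
    totallyChiralAlternating = hypermap , transitive , orientablyRegular , totallyChiral , monIsoAlt

totallyChiralAlternating₇ : TotallyChiralAlternating 7
totallyChiralAlternating₇ = totallyChiralAlternating
  (inChiralityGroup-by-evaluation (cycle₃ 0) (ℓ ∷ ℓ⁻ ∷ ℓ⁻ ∷ ρ⁻ ∷ ℓ⁻ ∷ ρ ∷ ρ ∷ ℓ⁻ ∷ ℓ⁻ ∷ ρ⁻ ∷ ℓ⁻ ∷ ρ ∷ ρ ∷ ℓ⁻ ∷ []))
  (inChiralityGroup-by-evaluation (cycle₃ 1) (ℓ⁻ ∷ ℓ⁻ ∷ ℓ⁻ ∷ ℓ⁻ ∷ ρ⁻ ∷ ℓ⁻ ∷ ρ ∷ ρ ∷ ℓ⁻ ∷ ℓ⁻ ∷ ρ⁻ ∷ ℓ⁻ ∷ ρ ∷ ρ ∷ ℓ ∷ ℓ ∷ []))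
  where open Generators 2

totallyChiralAlternating₈ : TotallyChiralAlternating 8
totallyChiralAlternating₈ = totallyChiralAlternating
  (inChiralityGroup-by-evaluation (cycle₃ 0) u)
  (inChiralityGroup-by-evaluation (cycle₃ 1) (ℓ ∷ ℓ ∷ ρ⁻ ∷ ρ⁻ ∷ ℓ ∷ ρ ∷ ℓ⁻ ∷ ρ⁻ ∷ ℓ ∷ ρ⁻ ∷ ρ⁻ ∷ ℓ ∷ ρ ∷ ℓ⁻ ∷ ρ⁻ ∷ ℓ⁻ ∷ u))
  where
  open Generators 3
  u = ℓ ∷ ℓ ∷ ρ⁻ ∷ ℓ⁻ ∷ ρ ∷ ρ ∷ ℓ⁻ ∷ ρ ∷ ℓ ∷ ρ⁻ ∷ ℓ⁻ ∷ ρ ∷ ρ ∷ ℓ⁻ ∷ ρ ∷ ℓ⁻ ∷ []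

record Extends (e : Fin q → Fin n) (M : Fin q → Fin q) (X : Fin n → Fin n) : Set where
  constructor extends
  field
    moves : ∀ i → X (e i) ≡ e (M i)
    fixes : ∀ y → (∀ i → e i ≢ y) → X y ≡ y

extends-id : (e : Fin q → Fin n) → Extends e (λ i → i) (λ y → y)
extends-id e = extends (λ _ → refl) (λ _ _ → refl)

extends-∘ : ∀ {e : Fin q → Fin n} {M N X Y} → Extends e M X → Extends e N Y →
            Extends e (λ i → M (N i)) (λ y → X (Y y))
extends-∘ {X = X} (extends X∘e X-fix) (extends Y∘e Y-fix) =
  extends (λ i → trans (cong X (Y∘e i)) (X∘e _)) (λ y y∉e → trans (cong X (Y-fix y y∉e)) (X-fix y y∉e))

extends-unique : ∀ {e : Fin q → Fin n} {M X Y} → Extends e M X → Extends e M Y → X ≗ Y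
extends-unique {e = e} (extends X∘e X-fix) (extends Y∘e Y-fix) y with any? (λ i → e i ≟ y)
... | yes (i , refl) = trans (X∘e i) (sym (Y∘e i))
... | no y∉e         = trans (X-fix y λ i eq → y∉e (i , eq)) (sym (Y-fix y λ i eq → y∉e (i , eq)))

extends-resp : ∀ {e : Fin q → Fin n} {M M′ X X′} → M ≗ M′ → X ≗ X′ → Extends e M X → Extends e M′ X′
extends-resp {e = e} M≗M′ X≗X′ (extends X∘e X-fix) =
  extends (λ i → trans (sym (X≗X′ _)) (trans (X∘e i) (cong e (M≗M′ i))))
          (λ y y∉e → trans (sym (X≗X′ y)) (X-fix y y∉e))

extends-reindex : ∀ {e e′ : Fin q → Fin n} {M X} → e ≗ e′ → Extends e M X → Extends e′ M X
extends-reindex {X = X} e≗e′ (extends X∘e X-fix) =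
  extends (λ i → trans (cong X (sym (e≗e′ i))) (trans (X∘e i) (e≗e′ _)))
          (λ y y∉e′ → X-fix y (λ i eq → y∉e′ i (trans (sym (e≗e′ i)) eq)))

extends-conj : ∀ {e : Fin q → Fin n} {M X} (g : Permutation′ n) → Extends e M X →
               Extends (λ i → g ⟨$⟩ʳ e i) M (λ y → g ⟨$⟩ʳ X (g ⟨$⟩ˡ y))
extends-conj {X = X} g (extends X∘e X-fix) =
  extends (λ i → cong (g ⟨$⟩ʳ_) (trans (cong X (inverseˡ g)) (X∘e i)))
          (λ y y∉ge → trans (cong (g ⟨$⟩ʳ_) (X-fix _ λ i eq → y∉ge i (trans (cong (g ⟨$⟩ʳ_) eq) (inverseʳ g))))
                            (inverseʳ g))

extends-inverse : ∀ {e : Fin q → Fin n} {M M′ X X′} → (∀ i → M (M′ i) ≡ i) → (∀ y → X′ (X y) ≡ y) →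
                  Extends e M X → Extends e M′ X′
extends-inverse {e = e} {M} {M′} {X} {X′} MM′≡id X′X≡id (extends X∘e X-fix) =
  extends (λ i → trans (cong (λ j → X′ (e j)) (sym (MM′≡id i))) (trans (cong X′ (sym (X∘e (M′ i)))) (X′X≡id _)))
          (λ y y∉e → trans (cong X′ (sym (X-fix y y∉e))) (X′X≡id y))

pushforward : (ι : Fin p → Fin q) (M : Fin p → Fin p) → Fin q → Fin q
pushforward ι M j with any? (λ i → ι i ≟ j)
... | yes (i , _) = ι (M i)
... | no _        = j

extends-pushforward : ∀ (e : Fin q → Fin n) → (∀ {i j} → e i ≡ e j → i ≡ j) →
                      ∀ (ι : Fin p → Fin q) {M X} → Extends (λ i → e (ι i)) M X → Extends e (pushforward ι M) X
extends-pushforward e e-injective ι {M} {X} (extends X∘eι X-fix) =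
  extends X∘e (λ y y∉e → X-fix y λ i → y∉e (ι i))
  where
  X∘e : ∀ j → X (e j) ≡ e (pushforward ι M j)
  X∘e j with any? (λ i → ι i ≟ j)
  ... | yes (i , refl) = X∘eι i
  ... | no j∉ι         = X-fix (e j) λ i eq → j∉ι (i , e-injective eq)

data Block : Set where
  a a⁻¹ bab⁻¹ ba⁻¹b⁻¹ b⁻¹ab b⁻¹a⁻¹b : Block

blockWord : Block → Word
blockWord a        = ρ ∷ []
blockWord a⁻¹      = ρ⁻ ∷ []
blockWord bab⁻¹    = ℓ ∷ ρ ∷ ℓ⁻ ∷ []
blockWord ba⁻¹b⁻¹  = ℓ ∷ ρ⁻ ∷ ℓ⁻ ∷ []
blockWord b⁻¹ab    = ℓ⁻ ∷ ρ ∷ ℓ ∷ []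
blockWord b⁻¹a⁻¹b  = ℓ⁻ ∷ ρ⁻ ∷ ℓ ∷ []

reflect : Block → Block
reflect a       = a⁻¹
reflect a⁻¹     = a
reflect bab⁻¹   = b⁻¹a⁻¹b
reflect ba⁻¹b⁻¹ = b⁻¹ab
reflect b⁻¹ab   = ba⁻¹b⁻¹
reflect b⁻¹a⁻¹b = bab⁻¹

conjR₂-blockWord : ∀ β → conjR₂ (blockWord β) ≡ blockWord (reflect β)
conjR₂-blockWord a       = refl
conjR₂-blockWord a⁻¹     = refl
conjR₂-blockWord bab⁻¹   = refl
conjR₂-blockWord ba⁻¹b⁻¹ = refl
conjR₂-blockWord b⁻¹ab   = refl
conjR₂-blockWord b⁻¹a⁻¹b = refl

blocksWord : List Block → Word
blocksWord []       = []
blocksWord (β ∷ βs) = blockWord β ++ blocksWord βs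

conjR₂-blocksWord : ∀ βs → conjR₂ (blocksWord βs) ≡ blocksWord (map reflect βs)
conjR₂-blocksWord []       = refl
conjR₂-blocksWord (β ∷ βs) = trans (map-++ invL (blockWord β) (blocksWord βs))
                                   (cong₂ _++_ (conjR₂-blockWord β) (conjR₂-blocksWord βs))

-- a moves 0, …, 4, which are the window positions 2, …, 6; its conjugates by b and b⁻¹ move
-- the window positions 4, …, 8 and 0, …, 4.
blockOffset : Block → Fin 5 → Fin 9
blockOffset a        i = (2 ↑ʳ i) ↑ˡ 2
blockOffset a⁻¹      i = (2 ↑ʳ i) ↑ˡ 2
blockOffset bab⁻¹    i = 4 ↑ʳ i
blockOffset ba⁻¹b⁻¹  i = 4 ↑ʳ i
blockOffset b⁻¹ab    i = i ↑ˡ 4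
blockOffset b⁻¹a⁻¹b  i = i ↑ˡ 4

blockCycle : Block → Fin 5 → Fin 5
blockCycle a       = fiveCycleᶠ
blockCycle a⁻¹     = fiveCycleᶠ⁻¹
blockCycle bab⁻¹   = fiveCycleᶠ
blockCycle ba⁻¹b⁻¹ = fiveCycleᶠ⁻¹
blockCycle b⁻¹ab   = fiveCycleᶠ
blockCycle b⁻¹a⁻¹b = fiveCycleᶠ⁻¹

blockModel : Block → Fin 9 → Fin 9
blockModel β = pushforward (blockOffset β) (blockCycle β)

blocksModel : List Block → Fin 9 → Fin 9
blocksModel []       i = i
blocksModel (β ∷ βs) i = blockModel β (blocksModel βs i)

module Window (k : ℕ) where
  open Generators (4 + k)

  private
    b : Permutation′ (5 + (4 + k))
    b = rotation ∘ₚ rotation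

  -- window i = i − 2 modulo 9 + k, so the window consists of −2, −1, 0, …, 6.
  window : Fin 9 → Fin (5 + (4 + k))
  window i = b ⟨$⟩ˡ (i ↑ˡ k)

  window-injective : ∀ {i j} → window i ≡ window j → i ≡ j
  window-injective {i} {j} eq = ↑ˡ-injective k i j (trans (sym (inverseʳ b)) (trans (cong (b ⟨$⟩ʳ_) eq) (inverseʳ b)))

  fiveCycle-extends : Extends (_↑ˡ (4 + k)) (fiveCycleᶠ {0}) (fiveCycle {4 + k} ⟨$⟩ʳ_)
  fiveCycle-extends = extends moved fixed
    where
    moved : ∀ (i : Fin 5) → fiveCycleᶠ (i ↑ˡ (4 + k)) ≡ fiveCycleᶠ i ↑ˡ (4 + k)
    moved 0F = refl
    moved 1F = refl
    moved 2F = refl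
    moved 3F = refl
    moved 4F = refl
    fixed : ∀ y → (∀ (i : Fin 5) → i ↑ˡ (4 + k) ≢ y) → fiveCycleᶠ {4 + k} y ≡ y
    fixed 0F y∉ = ⊥-elim (y∉ 0F refl)
    fixed 1F y∉ = ⊥-elim (y∉ 1F refl)
    fixed 2F y∉ = ⊥-elim (y∉ 2F refl)
    fixed 3F y∉ = ⊥-elim (y∉ 3F refl)
    fixed 4F y∉ = ⊥-elim (y∉ 4F refl)
    fixed (suc (suc (suc (suc (suc y))))) _ = refl

  fiveCycle⁻¹-extends : Extends (_↑ˡ (4 + k)) (fiveCycleᶠ⁻¹ {0}) (flip (fiveCycle {4 + k}) ⟨$⟩ʳ_)
  fiveCycle⁻¹-extends =
    extends-inverse (λ _ → inverseʳ (fiveCycle {0})) (λ _ → inverseˡ (fiveCycle {4 + k})) fiveCycle-extends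

  window-offset₂ : ∀ (i : Fin 5) → i ↑ˡ (4 + k) ≡ window ((2 ↑ʳ i) ↑ˡ 2)
  window-offset₂ 0F = refl
  window-offset₂ 1F = refl
  window-offset₂ 2F = refl
  window-offset₂ 3F = refl
  window-offset₂ 4F = refl

  window-offset₄ : ∀ (i : Fin 5) → b ⟨$⟩ʳ (i ↑ˡ (4 + k)) ≡ window (4 ↑ʳ i)
  window-offset₄ 0F = refl
  window-offset₄ 1F = refl
  window-offset₄ 2F = refl
  window-offset₄ 3F = refl
  window-offset₄ 4F = refl

  window-offset₀ : ∀ (i : Fin 5) → b ⟨$⟩ˡ (i ↑ˡ (4 + k)) ≡ window (i ↑ˡ 4)
  window-offset₀ 0F = refl
  window-offset₀ 1F = refl
  window-offset₀ 2F = refl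
  window-offset₀ 3F = refl
  window-offset₀ 4F = refl

  offset-extends : ∀ β → Extends (λ i → window (blockOffset β i)) (blockCycle β) (⟦ blockWord β ⟧ ⟨$⟩ʳ_)
  offset-extends a        = extends-reindex window-offset₂ fiveCycle-extends
  offset-extends a⁻¹      = extends-reindex window-offset₂ fiveCycle⁻¹-extends
  offset-extends bab⁻¹    = extends-reindex window-offset₄ (extends-conj {X = fiveCycle ⟨$⟩ʳ_} b fiveCycle-extends)
  offset-extends ba⁻¹b⁻¹  = extends-reindex window-offset₄ (extends-conj {X = flip fiveCycle ⟨$⟩ʳ_} b fiveCycle⁻¹-extends)
  offset-extends b⁻¹ab    = extends-reindex window-offset₀ (extends-conj {X = fiveCycle ⟨$⟩ʳ_} (flip b) fiveCycle-extends)
  offset-extends b⁻¹a⁻¹b  = extends-reindex window-offset₀ (extends-conj {X = flip fiveCycle ⟨$⟩ʳ_} (flip b) fiveCycle⁻¹-extends)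

  blockWord-extends : ∀ β → Extends window (blockModel β) (⟦ blockWord β ⟧ ⟨$⟩ʳ_)
  blockWord-extends β = extends-pushforward window window-injective (blockOffset β) (offset-extends β)

  blocksWord-extends : ∀ βs → Extends window (blocksModel βs) (⟦ blocksWord βs ⟧ ⟨$⟩ʳ_)
  blocksWord-extends []       = extends-id window
  blocksWord-extends (β ∷ βs) =
    extends-resp (λ _ → refl) (λ y → sym (⟦⟧-++ (blockWord β) (blocksWord βs) y))
      (extends-∘ (blockWord-extends β) (blocksWord-extends βs))

  cycle₃-extends₀ : Extends window (cycle₃ 2 ⟨$⟩ʳ_) (cycle₃ 0 ⟨$⟩ʳ_)
  cycle₃-extends₀ = extends moved fixed
    where
    moved : ∀ i → swap 0 (swap 1 (window i)) ≡ window (swap 2 (swap 3 i))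
    moved 0F = refl
    moved 1F = refl
    moved 2F = refl
    moved 3F = refl
    moved 4F = refl
    moved 5F = refl
    moved 6F = refl
    moved 7F = refl
    moved 8F = refl
    fixed : ∀ y → (∀ i → window i ≢ y) → swap 0 (swap 1 y) ≡ y
    fixed 0F y∉ = ⊥-elim (y∉ 2F refl)
    fixed 1F y∉ = ⊥-elim (y∉ 3F refl)
    fixed 2F y∉ = ⊥-elim (y∉ 4F refl)
    fixed (suc (suc (suc y))) _ = refl

  cycle₃-extends₁ : Extends window (cycle₃ 3 ⟨$⟩ʳ_) (cycle₃ 1 ⟨$⟩ʳ_)
  cycle₃-extends₁ = extends moved fixed
    where
    moved : ∀ i → swap 1 (swap 2 (window i)) ≡ window (swap 3 (swap 4 i))
    moved 0F = refl
    moved 1F = refl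
    moved 2F = refl
    moved 3F = refl
    moved 4F = refl
    moved 5F = refl
    moved 6F = refl
    moved 7F = refl
    moved 8F = refl
    fixed : ∀ y → (∀ i → window i ≢ y) → swap 1 (swap 2 y) ≡ y
    fixed 0F _  = refl
    fixed 1F y∉ = ⊥-elim (y∉ 3F refl)
    fixed 2F y∉ = ⊥-elim (y∉ 4F refl)
    fixed 3F y∉ = ⊥-elim (y∉ 5F refl)
    fixed (suc (suc (suc (suc y)))) _ = refl

  blocks-inChiralityGroup : ∀ i → Extends window (cycle₃ (2 + i) ⟨$⟩ʳ_) (cycle₃ i ⟨$⟩ʳ_) → ∀ βs →
                            {True (all? λ j → blocksModel βs j ≟ cycle₃ (2 + i) ⟨$⟩ʳ j)} →
                            {True (all? λ j → blocksModel (map reflect βs) j ≟ j)} →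
                            InChiralityGroup (cycle₃ i)
  blocks-inChiralityGroup i cycle₃-extends βs {model≗} {reflected-model≗id} =
    blocksWord βs ,
    extends-unique (extends-resp (toWitness model≗) (λ _ → refl) (blocksWord-extends βs)) cycle₃-extends ,
    λ y → trans (cong (λ w → ⟦ w ⟧ ⟨$⟩ʳ y) (conjR₂-blocksWord βs))
      (extends-unique (extends-resp (toWitness reflected-model≗id) (λ _ → refl) (blocksWord-extends (map reflect βs)))
                      (extends-id window) y)

  totallyChiralAlternating₉₊ : TotallyChiralAlternating (9 + k)
  totallyChiralAlternating₉₊ = totallyChiralAlternating
    (blocks-inChiralityGroup 0 cycle₃-extends₀
      (bab⁻¹ ∷ a ∷ ba⁻¹b⁻¹ ∷ a ∷ a ∷ bab⁻¹ ∷ a ∷ ba⁻¹b⁻¹ ∷ a ∷ a ∷ bab⁻¹ ∷ ba⁻¹b⁻¹ ∷ bab⁻¹ ∷ a ∷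
       b⁻¹a⁻¹b ∷ ba⁻¹b⁻¹ ∷ b⁻¹ab ∷ bab⁻¹ ∷ a ∷ b⁻¹a⁻¹b ∷ ba⁻¹b⁻¹ ∷ b⁻¹ab ∷ bab⁻¹ ∷ ba⁻¹b⁻¹ ∷ []))
    (blocks-inChiralityGroup 1 cycle₃-extends₁
      (b⁻¹a⁻¹b ∷ ba⁻¹b⁻¹ ∷ b⁻¹ab ∷ bab⁻¹ ∷ a ∷ b⁻¹a⁻¹b ∷ ba⁻¹b⁻¹ ∷ b⁻¹ab ∷ bab⁻¹ ∷ a ∷ b⁻¹ab ∷ a⁻¹ ∷
       ba⁻¹b⁻¹ ∷ b⁻¹a⁻¹b ∷ bab⁻¹ ∷ b⁻¹ab ∷ a⁻¹ ∷ ba⁻¹b⁻¹ ∷ b⁻¹a⁻¹b ∷ bab⁻¹ ∷ []))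

theorem13 : ∀ (n : ℕ) → 7 ≤ n →
    ∃ λ (H : Hypermap) →
      Transitive H × OrientablyRegular H × TotallyChiral H × MonIsoAlt H n
theorem13 n 7≤n with ℕ.m≤n⇒∃[o]m+o≡n 7≤n
... | zero          , refl = totallyChiralAlternating₇
... | suc zero      , refl = totallyChiralAlternating₈
... | suc (suc k)   , refl = Window.totallyChiralAlternating₉₊ k
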